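{- Let $G$ be a graph of order $n>3$ with $\chi_D(G)=n-1$. Then: (a) $\chi_D(G\cup G)=\chi_D(G)$ if and only if either ($a_1$) $G$ is the join of a nonvacuous complete multipartite graph with one of $2K_2$ or $H\cup K_1$, or ($a_2$) $G\cong H\cup K_1$ with $H\not\cong K_{n-1}$; (b) $\chi_D(G\cup G)=\chi_D(G)+1$ if and only if $G$ is $2K_2$ or $K_{n-1}\cup K_1$. Here $H$ denotes a complete multipartite graph with at least two parts.
   Context: $G\cup G$ is the disjoint union of two copies of $G$; $\cup$ denotes disjoint union and the join $A\vee B$ is the disjoint union of $A$ and $B$ together with all edges between $A$ and $B$. A distinguishing $k$-coloring of a graph is a partition of its vertex set into exactly $k$ non-empty independent sets such that the only automorphism mapping every class onto itself is the identity; $\chi_D$ is the least such $k$. Complete multipartite graphs include edgeless graphs (independent sets, viewed as having one part) and complete graphs; "nonvacuous" means having at least one vertex. -}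

module Defs where

open import Data.Nat using (ℕ; suc; _≤_)
open import Data.Fin using (Fin; splitAt; _≟_)
open import Data.Bool using (Bool; true; false; not)
open import Data.Sum using (_⊎_; inj₁; inj₂)
open import Data.Product using (Σ; ∃; _×_; _,_)
open import Relation.Nullary using (¬_; does)
open import Relation.Binary.PropositionalEquality using (_≡_; _≢_; refl)

record Graph (n : ℕ) : Set where
  field
    adj : Fin n → Fin n → Bool
    adj-sym : ∀ i j → adj i j ≡ adj j i
    adj-irr : ∀ i → adj i i ≡ false
open Graph public

record _≅_ {m n : ℕ} (G : Graph m) (H : Graph n) : Set where
  field
    to : Fin m → Fin n
    from : Fin n → Fin m
    to-from : ∀ j → to (from j) ≡ j
    from-to : ∀ i → from (to i) ≡ i
    preserves : ∀ i j → adj H (to i) (to j) ≡ adj G i j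
open _≅_ public

Aut : {n : ℕ} → Graph n → Set
Aut G = G ≅ G

K : (n : ℕ) → Graph n
K n = record
  { adj = λ i j → not (does (i ≟ j))
  ; adj-sym = sym'
  ; adj-irr = irr' }
  where
  sym' : ∀ i j → not (does (i ≟ j)) ≡ not (does (j ≟ i))
  sym' i j with i ≟ j | j ≟ i
  ... | Relation.Nullary.yes _ | Relation.Nullary.yes _ = refl
  ... | Relation.Nullary.no _ | Relation.Nullary.no _ = refl
  ... | Relation.Nullary.yes refl | Relation.Nullary.no ¬p = Data.Empty.⊥-elim (¬p refl)
    where import Data.Empty
  ... | Relation.Nullary.no ¬p | Relation.Nullary.yes refl = Data.Empty.⊥-elim (¬p refl)
    where import Data.Empty
  irr' : ∀ i → not (does (i ≟ i)) ≡ false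
  irr' i with i ≟ i
  ... | Relation.Nullary.yes _ = refl
  ... | Relation.Nullary.no ¬p = Data.Empty.⊥-elim (¬p refl)
    where import Data.Empty

module _ {m n : ℕ} (cross : Bool) (G : Graph m) (H : Graph n) where
  private
    h : Fin m ⊎ Fin n → Fin m ⊎ Fin n → Bool
    h (inj₁ a) (inj₁ b) = adj G a b
    h (inj₂ a) (inj₂ b) = adj H a b
    h (inj₁ _) (inj₂ _) = cross
    h (inj₂ _) (inj₁ _) = cross

    h-sym : ∀ x y → h x y ≡ h y x
    h-sym (inj₁ a) (inj₁ b) = adj-sym G a b
    h-sym (inj₂ a) (inj₂ b) = adj-sym H a b
    h-sym (inj₁ _) (inj₂ _) = refl
    h-sym (inj₂ _) (inj₁ _) = refl

    h-irr : ∀ x → h x x ≡ false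
    h-irr (inj₁ a) = adj-irr G a
    h-irr (inj₂ a) = adj-irr H a

  combine : Graph (m Data.Nat.+ n)
  combine = record
    { adj = λ i j → h (splitAt m i) (splitAt m j)
    ; adj-sym = λ i j → h-sym (splitAt m i) (splitAt m j)
    ; adj-irr = λ i → h-irr (splitAt m i) }

_∪_ : {m n : ℕ} → Graph m → Graph n → Graph (m Data.Nat.+ n)
G ∪ H = combine false G H

_∨_ : {m n : ℕ} → Graph m → Graph n → Graph (m Data.Nat.+ n)
G ∨ H = combine true G H

2K₂ : Graph 4
2K₂ = K 2 ∪ K 2

IsCompleteMultipartite : {n : ℕ} → Graph n → ℕ → Set
IsCompleteMultipartite {n} G k =
  Σ (Fin n → Fin k) λ p →
    (∀ c → ∃ λ i → p i ≡ c) ×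
    (∀ i j → (adj G i j ≡ true → p i ≢ p j) × (p i ≢ p j → adj G i j ≡ true))

CompleteMultipartite : {n : ℕ} → Graph n → Set
CompleteMultipartite G = ∃ λ k → IsCompleteMultipartite G k

CompleteMultipartite≥2 : {n : ℕ} → Graph n → Set
CompleteMultipartite≥2 G = ∃ λ k → 2 ≤ k × IsCompleteMultipartite G k

record DistColoring {n : ℕ} (G : Graph n) (k : ℕ) : Set where
  field
    col : Fin n → Fin k
    surj : ∀ c → ∃ λ i → col i ≡ c
    proper : ∀ i j → adj G i j ≡ true → col i ≢ col j
    distinguishing : (σ : Aut G) → (∀ i → col (to σ i) ≡ col i) → ∀ i → to σ i ≡ i

IsχD : {n : ℕ} → Graph n → ℕ → Set
IsχD G k = DistColoring G k × (∀ m → DistColoring G m → k ≤ m)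

-- Let G have n vertices and χ_D(G) = n − 1. Call two distinct, non-adjacent vertices that are not
-- twins a bad pair. Merging colours in the identity colouring, which would give a distinguishing
-- colouring with n − 2 colours, shows that any three independent vertices contain twins and that of
-- two disjoint non-edges one is a twin pair or the product of the two transpositions is an
-- automorphism. Consequently the good (non-bad) vertices induce a complete multipartite M joined to
-- everything else, and the bad vertices induce 2K₂ or H ∪ K₁; this gives G ≅ M ∨ 2K₂, M ∨ (H ∪ K₁)
-- or, when M is empty, 2K₂ or H ∪ K₁.
--
-- A distinguishing colouring of G ∪ G restricts to one of G, so χ_D(G ∪ G) ≥ n − 1. Conversely, in
-- each case other than 2K₂ and K_{n−1} ∪ K₁ there are two proper rigid (n − 1)-colourings of G such
-- that no colour-preserving map sends one copy onto the other; colouring the two copies with them is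
-- distinguishing. For 2K₂ ∪ 2K₂ and 2(K_{n−1} ∪ K₁), any (n − 1)-colouring is preserved by exchanging
-- two components, and n colours suffice.

module Submission where

open import Defs
open import Data.Nat using (ℕ; zero; suc; _+_; _∸_; _≤_; _<_; z≤n; s≤s)
import Data.Nat.Properties as ℕ
open import Data.Fin as F using (Fin; zero; suc; _≟_; _↑ˡ_; _↑ʳ_; splitAt; punchOut)
open import Data.Fin.Patterns using (0F; 1F; 2F; 3F; 4F; 5F; 6F; 7F)
open import Data.Fin.Properties as FP using (all?; any?; ¬∀⟶∃¬; splitAt-↑ˡ; splitAt-↑ʳ; splitAt⁻¹-↑ˡ; splitAt⁻¹-↑ʳ; punchOut-injective; punchOut-cong; pigeonhole; injective⇒≤)
open import Data.Bool using (Bool; true; false; not)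
open import Data.Bool.Properties using () renaming (_≟_ to _≟B_)
open import Data.Maybe using (Maybe; just; nothing; fromMaybe)
import Data.Maybe as Maybe
open import Data.Sum using (_⊎_; inj₁; inj₂; [_,_]′)
import Data.Sum as Sum
open import Data.Product using (Σ; ∃; ∃₂; _×_; _,_; proj₁; proj₂)
open import Data.Unit using (⊤; tt)
open import Data.Empty using (⊥; ⊥-elim)
open import Relation.Nullary using (¬_; Dec; yes; no)
open import Relation.Nullary.Decidable using (_×-dec_; _→-dec_; _⊎-dec_; ¬?; toWitness; decidable-stable)
open import Relation.Binary.PropositionalEquality
open import Function.Base using (_∘_; id)
open import Function.Bundles using (_⇔_; mk⇔)


-- Disjoint unions and joins

data Split (m n : ℕ) : Fin (m + n) → Set where
  inl : (i : Fin m) → Split m n (i ↑ˡ n)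
  inr : (j : Fin n) → Split m n (m ↑ʳ j)

split : ∀ m n (x : Fin (m + n)) → Split m n x
split m n x with splitAt m x in eq
... | inj₁ i = subst (Split m n) (splitAt⁻¹-↑ˡ eq) (inl i)
... | inj₂ j = subst (Split m n) (splitAt⁻¹-↑ʳ eq) (inr j)

↑ˡ-inj : ∀ {m} n {i j : Fin m} → i ↑ˡ n ≡ j ↑ˡ n → i ≡ j
↑ˡ-inj {m} n {i} {j} e = FP.↑ˡ-injective n i j e

↑ʳ-inj : ∀ m {n} {i j : Fin n} → m ↑ʳ i ≡ m ↑ʳ j → i ≡ j
↑ʳ-inj m {n} {i} {j} e = FP.↑ʳ-injective m i j e

↑ˡ≢↑ʳ : ∀ {m n} (i : Fin m) (j : Fin n) → i ↑ˡ n ≢ m ↑ʳ j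
↑ˡ≢↑ʳ {m} {n} i j e with trans (sym (splitAt-↑ˡ m i n)) (trans (cong (splitAt m) e) (splitAt-↑ʳ m n j))
... | ()

module _ {m n : ℕ} (b : Bool) (G : Graph m) (H : Graph n) where
  adj-ll : ∀ i j → adj (combine b G H) (i ↑ˡ n) (j ↑ˡ n) ≡ adj G i j
  adj-ll i j rewrite splitAt-↑ˡ m i n | splitAt-↑ˡ m j n = refl
  adj-rr : ∀ i j → adj (combine b G H) (m ↑ʳ i) (m ↑ʳ j) ≡ adj H i j
  adj-rr i j rewrite splitAt-↑ʳ m n i | splitAt-↑ʳ m n j = refl
  adj-lr : ∀ i j → adj (combine b G H) (i ↑ˡ n) (m ↑ʳ j) ≡ b
  adj-lr i j rewrite splitAt-↑ˡ m i n | splitAt-↑ʳ m n j = refl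
  adj-rl : ∀ i j → adj (combine b G H) (m ↑ʳ j) (i ↑ˡ n) ≡ b
  adj-rl i j rewrite splitAt-↑ˡ m i n | splitAt-↑ʳ m n j = refl

≅-refl : ∀ {n} (G : Graph n) → G ≅ G
≅-refl G = record { to = λ i → i ; from = λ i → i ; to-from = λ _ → refl ; from-to = λ _ → refl ; preserves = λ _ _ → refl }

≅-sym : ∀ {m n} {G : Graph m} {H : Graph n} → G ≅ H → H ≅ G
≅-sym {G = G} {H} φ = record { to = from φ ; from = to φ ; to-from = from-to φ ; from-to = to-from φ
  ; preserves = λ i j → trans (sym (preserves φ (from φ i) (from φ j))) (cong₂ (adj H) (to-from φ i) (to-from φ j)) }

≅-trans : ∀ {m n k} {G : Graph m} {H : Graph n} {J : Graph k} → G ≅ H → H ≅ J → G ≅ J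
≅-trans φ ψ = record { to = λ i → to ψ (to φ i) ; from = λ i → from φ (from ψ i)
  ; to-from = λ j → trans (cong (to ψ) (to-from φ (from ψ j))) (to-from ψ j)
  ; from-to = λ i → trans (cong (from φ) (from-to ψ (to φ i))) (from-to φ i)
  ; preserves = λ i j → trans (preserves ψ (to φ i) (to φ j)) (preserves φ i j) }

to-injective : ∀ {m n} {G : Graph m} {H : Graph n} (φ : G ≅ H) {i j} → to φ i ≡ to φ j → i ≡ j
to-injective φ {i} {j} e = trans (sym (from-to φ i)) (trans (cong (from φ) e) (from-to φ j))

≅-order : ∀ {m n} {G : Graph m} {H : Graph n} → G ≅ H → m ≡ n
≅-order φ = FP.cantor-schröder-bernstein (to-injective φ) (to-injective (≅-sym φ))

from-preserves : ∀ {m n} {G : Graph m} {H : Graph n} (φ : G ≅ H) i j → adj G (from φ i) (from φ j) ≡ adj H i j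
from-preserves φ i j = preserves (≅-sym φ) i j

mapSplit : ∀ {m n m' n'} → (Fin m → Fin m') → (Fin n → Fin n') → Fin (m + n) → Fin (m' + n')
mapSplit {m} {n} {m'} {n'} f g x = [ (λ i → f i ↑ˡ n') , (λ j → m' ↑ʳ g j) ]′ (splitAt m x)

mapSplit-↑ˡ : ∀ {m n m' n'} (f : Fin m → Fin m') (g : Fin n → Fin n') i → mapSplit f g (i ↑ˡ n) ≡ f i ↑ˡ n'
mapSplit-↑ˡ {m} {n} f g i rewrite splitAt-↑ˡ m i n = refl

mapSplit-↑ʳ : ∀ {m n m' n'} (f : Fin m → Fin m') (g : Fin n → Fin n') j → mapSplit {m} f g (m ↑ʳ j) ≡ m' ↑ʳ g j
mapSplit-↑ʳ {m} {n} f g j rewrite splitAt-↑ʳ m n j = refl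

mapSplit-inverse : ∀ {m n m' n'} {f : Fin m → Fin m'} {g : Fin n → Fin n'} {f' : Fin m' → Fin m} {g' : Fin n' → Fin n}
  → (∀ i → f' (f i) ≡ i) → (∀ j → g' (g j) ≡ j) → ∀ x → mapSplit f' g' (mapSplit f g x) ≡ x
mapSplit-inverse {m} {n} {m'} {f = f} {g} {f'} {g'} ef eg x with split m n x
... | inl i = trans (cong (mapSplit f' g') (mapSplit-↑ˡ f g i)) (trans (mapSplit-↑ˡ f' g' (f i)) (cong (_↑ˡ n) (ef i)))
... | inr j = trans (cong (mapSplit f' g') (mapSplit-↑ʳ f g j)) (trans (mapSplit-↑ʳ {m'} f' g' (g j)) (cong (m ↑ʳ_) (eg j)))

combine-cong : ∀ {m n m' n'} (b : Bool) {G : Graph m} {H : Graph n} {G' : Graph m'} {H' : Graph n'}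
  → G ≅ G' → H ≅ H' → combine b G H ≅ combine b G' H'
combine-cong {m} {n} {m'} {n'} b {G} {H} {G'} {H'} φ ψ = record
  { to = mapSplit (to φ) (to ψ) ; from = mapSplit (from φ) (from ψ)
  ; to-from = mapSplit-inverse {f = from φ} {from ψ} (to-from φ) (to-from ψ)
  ; from-to = mapSplit-inverse {f = to φ} {to ψ} (from-to φ) (from-to ψ)
  ; preserves = pres }
  where
  pres : ∀ x y → adj (combine b G' H') (mapSplit (to φ) (to ψ) x) (mapSplit (to φ) (to ψ) y) ≡ adj (combine b G H) x y
  pres x y with split m n x | split m n y
  ... | inl i | inl j rewrite mapSplit-↑ˡ (to φ) (to ψ) i | mapSplit-↑ˡ (to φ) (to ψ) j = trans (adj-ll b G' H' _ _) (trans (preserves φ i j) (sym (adj-ll b G H i j)))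
  ... | inl i | inr j rewrite mapSplit-↑ˡ (to φ) (to ψ) i | mapSplit-↑ʳ {m} (to φ) (to ψ) j = trans (adj-lr b G' H' _ _) (sym (adj-lr b G H i j))
  ... | inr i | inl j rewrite mapSplit-↑ʳ {m} (to φ) (to ψ) i | mapSplit-↑ˡ (to φ) (to ψ) j = trans (adj-rl b G' H' _ _) (sym (adj-rl b G H j i))
  ... | inr i | inr j rewrite mapSplit-↑ʳ {m} (to φ) (to ψ) i | mapSplit-↑ʳ {m} (to φ) (to ψ) j = trans (adj-rr b G' H' _ _) (trans (preserves ψ i j) (sym (adj-rr b G H i j)))

-- Distinguishing colourings

Proper : ∀ {n m} → Graph n → (Fin n → Fin m) → Set
Proper G f = ∀ i j → adj G i j ≡ true → f i ≢ f j

Distinguishing : ∀ {n m} → Graph n → (Fin n → Fin m) → Set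
Distinguishing G f = (σ : Aut G) → (∀ i → f (to σ i) ≡ f i) → ∀ i → to σ i ≡ i

record Compression {n m : ℕ} (f : Fin n → Fin m) : Set where
  field
    j : ℕ
    j≤m : j ≤ m
    g : Fin n → Fin j
    gsurj : ∀ c → ∃ λ i → g i ≡ c
    g⇒f : ∀ i i' → g i ≡ g i' → f i ≡ f i'
    f⇒g : ∀ i i' → f i ≡ f i' → g i ≡ g i'

compress : ∀ {n} m (f : Fin n → Fin m) → Compression f
compress zero f = record { j = 0 ; j≤m = z≤n ; g = f ; gsurj = λ () ; g⇒f = λ _ _ e → e ; f⇒g = λ _ _ e → e }
compress {n} (suc m) f with all? (λ c → any? (λ i → f i ≟ c))
... | yes s = record { j = suc m ; j≤m = ℕ.≤-refl ; g = f ; gsurj = s ; g⇒f = λ _ _ e → e ; f⇒g = λ _ _ e → e }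
... | no ns with ¬∀⟶∃¬ (suc m) _ (λ c → any? (λ i → f i ≟ c)) ns
... | c , nc = record { j = Compression.j C ; j≤m = ℕ.m≤n⇒m≤1+n (Compression.j≤m C) ; g = Compression.g C
       ; gsurj = Compression.gsurj C
       ; g⇒f = λ i i' e → punchOut-injective (ne i) (ne i') (Compression.g⇒f C i i' e)
       ; f⇒g = λ i i' e → Compression.f⇒g C i i' (punchOut-cong c e) }
  where
  ne : ∀ i → c ≢ f i
  ne i e = nc (i , sym e)
  f' : Fin n → Fin m
  f' i = punchOut (ne i)
  C = compress m f'

proper-distinguishing⇒DistColoring : ∀ {n m} {G : Graph n} {f : Fin n → Fin m} → Proper G f → Distinguishing G f → Σ ℕ λ j → j ≤ m × DistColoring G j
proper-distinguishing⇒DistColoring {n} {m} {G} {f} pr di = j , j≤m , record { col = g ; surj = gsurj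
   ; proper = λ i i' a e → pr i i' a (g⇒f i i' e)
   ; distinguishing = λ σ h → di σ (λ i → g⇒f _ _ (h i)) }
  where open Compression (compress m f)

χD-≤ : ∀ {n m k} {G : Graph n} {f : Fin n → Fin m} → IsχD G k → Proper G f → Distinguishing G f → k ≤ m
χD-≤ (_ , mn) pr di with proper-distinguishing⇒DistColoring pr di
... | j , j≤m , D = ℕ.≤-trans (mn j D) j≤m

DistColoring-≅ : ∀ {m n k} {A : Graph m} {B : Graph n} → A ≅ B → DistColoring B k → DistColoring A k
DistColoring-≅ {A = A} {B} φ D = record
  { col = λ i → col (to φ i)
  ; surj = λ c → let (i , e) = surj c in from φ i , trans (cong col (to-from φ i)) e
  ; proper = λ i j a → proper (to φ i) (to φ j) (trans (preserves φ i j) a)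
  ; distinguishing = dis }
  where
  open DistColoring D
  dis : (σ : Aut A) → (∀ i → col (to φ (to σ i)) ≡ col (to φ i)) → ∀ i → to σ i ≡ i
  dis σ h i = to-injective φ (trans (cong (λ z → to φ (to σ z)) (sym (from-to φ i))) (fixed (to φ i)))
    where
    σ' : Aut B
    σ' = ≅-trans (≅-trans (≅-sym φ) σ) φ
    fixed : ∀ j → to φ (to σ (from φ j)) ≡ j
    fixed = distinguishing σ' (λ j → trans (h (from φ j)) (cong col (to-from φ j)))

restrictLeft : ∀ {n m} {G : Graph n} → (D : DistColoring (G ∪ G) m) →
  Proper G (λ i → DistColoring.col D (i ↑ˡ n)) × Distinguishing G (λ i → DistColoring.col D (i ↑ˡ n))
restrictLeft {n} {m} {G} D = (λ i j a e → proper (i ↑ˡ n) (j ↑ˡ n) (trans (adj-ll false G G i j) a) e) , dis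
  where
  open DistColoring D
  dis : Distinguishing G (λ i → col (i ↑ˡ n))
  dis τ h i = ↑ˡ-inj n (trans (sym (mapSplit-↑ˡ (to τ) (λ j → j) i)) (distinguishing ext hc (i ↑ˡ n)))
    where
    ext : Aut (G ∪ G)
    ext = combine-cong false τ (≅-refl G)
    hc : ∀ x → col (to ext x) ≡ col x
    hc x with split n n x
    ... | inl i' = trans (cong col (mapSplit-↑ˡ (to τ) (λ j → j) i')) (h i')
    ... | inr j' = cong col (mapSplit-↑ʳ {n} (to τ) (λ j → j) j')

∪-self-cong : ∀ {m n} {G : Graph m} {H : Graph n} → G ≅ H → (G ∪ G) ≅ (H ∪ H)
∪-self-cong φ = combine-cong false φ φ

-- Twins, transpositions and merged colours

Twins : ∀ {n} → Graph n → Fin n → Fin n → Set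
Twins G u v = ∀ w → adj G u w ≡ adj G v w

twins? : ∀ {n} (G : Graph n) u v → Dec (Twins G u v)
twins? G u v = all? (λ w → adj G u w ≟B adj G v w)

twins-sym : ∀ {n} {G : Graph n} {u v} → Twins G u v → Twins G v u
twins-sym t w = sym (t w)

twins-trans : ∀ {n} {G : Graph n} {u v w} → Twins G u v → Twins G v w → Twins G u w
twins-trans t s z = trans (t z) (s z)

swapAt : ∀ {n} (u v x : Fin n) → Dec (x ≡ u) → Dec (x ≡ v) → Fin n
swapAt u v x (yes _) _ = v
swapAt u v x (no _) (yes _) = u
swapAt u v x (no _) (no _) = x

swap : ∀ {n} → Fin n → Fin n → Fin n → Fin n
swap u v x = swapAt u v x (x ≟ u) (x ≟ v)

data SwapView {n} (u v x : Fin n) : Set where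
  isU : x ≡ u → swap u v x ≡ v → SwapView u v x
  isV : x ≢ u → x ≡ v → swap u v x ≡ u → SwapView u v x
  isO : x ≢ u → x ≢ v → swap u v x ≡ x → SwapView u v x

swap-view : ∀ {n} (u v x : Fin n) → SwapView u v x
swap-view u v x = go (x ≟ u) (x ≟ v) refl
  where
  go : (d1 : Dec (x ≡ u)) (d2 : Dec (x ≡ v)) → swap u v x ≡ swapAt u v x d1 d2 → SwapView u v x
  go (yes p) _ e = isU p e
  go (no p) (yes q) e = isV p q e
  go (no p) (no q) e = isO p q e

swap-u : ∀ {n} (u v : Fin n) → swap u v u ≡ v
swap-u u v with swap-view u v u
... | isU _ e = e
... | isV p _ _ = ⊥-elim (p refl)
... | isO p _ _ = ⊥-elim (p refl)

swap-v : ∀ {n} (u v : Fin n) → swap u v v ≡ u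
swap-v u v with swap-view u v v
... | isU p e = trans e p
... | isV _ _ e = e
... | isO _ q _ = ⊥-elim (q refl)

swap-other : ∀ {n} (u v x : Fin n) → x ≢ u → x ≢ v → swap u v x ≡ x
swap-other u v x p q with swap-view u v x
... | isU r _ = ⊥-elim (p r)
... | isV _ r _ = ⊥-elim (q r)
... | isO _ _ e = e

swap-involutive : ∀ {n} (u v x : Fin n) → swap u v (swap u v x) ≡ x
swap-involutive u v x with swap-view u v x
... | isU refl e = trans (cong (swap u v) e) (swap-v u v)
... | isV _ refl e = trans (cong (swap u v) e) (swap-u u v)
... | isO p q e = trans (cong (swap u v) e) e

involution⇒Aut : ∀ {n} (G : Graph n) (f : Fin n → Fin n) → (∀ i → f (f i) ≡ i) → (∀ i j → adj G (f i) (f j) ≡ adj G i j) → Aut G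
involution⇒Aut G f inv pres = record { to = f ; from = f ; to-from = inv ; from-to = inv ; preserves = pres }

swap-preserves : ∀ {n} (G : Graph n) {u v} → Twins G u v → ∀ x y → adj G (swap u v x) (swap u v y) ≡ adj G x y
swap-preserves G {u} {v} t x y with swap-view u v x | swap-view u v y
... | isU p e | isU q e' rewrite e | e' | p | q = trans (adj-irr G v) (sym (adj-irr G u))
... | isU p e | isV _ q e' rewrite e | e' | p | q = adj-sym G v u
... | isU p e | isO _ _ e' rewrite e | e' | p = sym (t y)
... | isV _ p e | isU q e' rewrite e | e' | p | q = adj-sym G u v
... | isV _ p e | isV _ q e' rewrite e | e' | p | q = trans (adj-irr G u) (sym (adj-irr G v))
... | isV _ p e | isO _ _ e' rewrite e | e' | p = t y
... | isO _ _ e | isU q e' rewrite e | e' | q = trans (adj-sym G x v) (trans (sym (t x)) (adj-sym G u x))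
... | isO _ _ e | isV _ q e' rewrite e | e' | q = trans (adj-sym G x u) (trans (t x) (adj-sym G v x))
... | isO _ _ e | isO _ _ e' rewrite e | e' = refl

twinSwap : ∀ {n} (G : Graph n) {u v} → Twins G u v → Aut G
twinSwap G {u} {v} t = involution⇒Aut G (swap u v) (swap-involutive u v) (swap-preserves G t)

merge : ∀ {k} (u v : Fin (suc k)) → u ≢ v → Fin (suc k) → Fin k
merge u v u≢v x with x ≟ v
... | yes _ = punchOut {i = v} {j = u} (λ e → u≢v (sym e))
... | no x≢v = punchOut {i = v} {j = x} (λ e → x≢v (sym e))

OneOf : ∀ {n} → Fin n → Fin n → Fin n → Set
OneOf u v x = x ≡ u ⊎ x ≡ v

merge-kernel : ∀ {k} (u v : Fin (suc k)) (p : u ≢ v) x y → merge u v p x ≡ merge u v p y → x ≡ y ⊎ (OneOf u v x × OneOf u v y)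
merge-kernel u v p x y e with x ≟ v | y ≟ v
... | yes a | yes b = inj₁ (trans a (sym b))
... | yes a | no b = inj₂ (inj₂ a , inj₁ (sym (punchOut-injective (λ e → p (sym e)) (λ e → b (sym e)) e)))
... | no a | yes b = inj₂ (inj₁ (punchOut-injective (λ e → a (sym e)) (λ e → p (sym e)) e) , inj₂ b)
... | no a | no b = inj₁ (punchOut-injective (λ e → a (sym e)) (λ e → b (sym e)) e)

true≢false : true ≢ false
true≢false ()

false≢true : false ≢ true
false≢true ()

adj-false : ∀ {n} (G : Graph n) i j → adj G i j ≢ true → adj G i j ≡ false
adj-false G i j ne with adj G i j
... | true = ⊥-elim (ne refl)
... | false = refl

not-twins : ∀ {n} (G : Graph n) {u v} z → adj G u z ≢ adj G v z → ¬ Twins G u v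
not-twins G z ne t = ne (t z)

adj⇒≢ : ∀ {n} (G : Graph n) {a b} → adj G a b ≡ true → a ≢ b
adj⇒≢ G {a} h refl = true≢false (trans (sym h) (adj-irr G a))

adj-nonadj⇒≢ : ∀ {n} (G : Graph n) {a b c} → adj G a b ≡ true → adj G a c ≡ false → b ≢ c
adj-nonadj⇒≢ G e1 e2 refl = true≢false (trans (sym e1) e2)

adj-false-sym : ∀ {n} (G : Graph n) {a b} → adj G a b ≡ false → adj G b a ≡ false
adj-false-sym G {a} {b} e = trans (adj-sym G b a) e

adj-true-sym : ∀ {n} (G : Graph n) {a b} → adj G a b ≡ true → adj G b a ≡ true
adj-true-sym G {a} {b} e = trans (adj-sym G b a) e

-- Graphs with χ_D = n − 1

module Extremal {k : ℕ} (G : Graph (suc (suc k))) (hχ : IsχD G (suc k)) where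

  no-smaller-distinguishing : ∀ {f : Fin (suc (suc k)) → Fin k} → Proper G f → Distinguishing G f → ⊥
  no-smaller-distinguishing pr di = ℕ.1+n≰n (χD-≤ hχ pr di)

  -- Two vertices of the same colour in a distinguishing (n − 1)-colouring are non-adjacent, and
  -- not twins, since swapping them would be a nontrivial colour-preserving automorphism.
  nontwin-nonedge : ∃₂ λ u v → u ≢ v × adj G u v ≡ false × ¬ Twins G u v
  nontwin-nonedge with proj₁ hχ
  ... | D with pigeonhole ℕ.≤-refl (DistColoring.col D)
  ... | i , j , i<j , e = i , j , ne , adj-false G i j (λ a → DistColoring.proper D i j a e) , ¬twins
    where
    open DistColoring D
    ne : i ≢ j
    ne refl = ℕ.<-irrefl refl i<j
    ¬twins : ¬ Twins G i j
    ¬twins t = ne (sym (trans (sym (swap-u i j)) (distinguishing (twinSwap G t) cp i)))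
      where
      cp : ∀ x → col (swap i j x) ≡ col x
      cp x with swap-view i j x
      ... | isU p q rewrite q | p = sym e
      ... | isV _ p q rewrite q | p = e
      ... | isO _ _ q rewrite q = refl

  -- Merging the colours of u, v, w in the identity colouring is proper; if no two of them were
  -- twins it would also be distinguishing, with only n − 2 colours.
  module _ (u v w : Fin (suc (suc k))) (uv : u ≢ v) (uw : u ≢ w) (vw : v ≢ w)
           (auv : adj G u v ≡ false) (auw : adj G u w ≡ false) (avw : adj G v w ≡ false) where
    private
      T : Fin (suc (suc k)) → Set
      T x = x ≡ u ⊎ x ≡ v ⊎ x ≡ w

      T? : ∀ x → Dec (T x)
      T? x with x ≟ u | x ≟ v | x ≟ w
      ... | yes a | _ | _ = yes (inj₁ a)
      ... | no _ | yes b | _ = yes (inj₂ (inj₁ b))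
      ... | no _ | no _ | yes c = yes (inj₂ (inj₂ c))
      ... | no a | no b | no c = no λ { (inj₁ p) → a p ; (inj₂ (inj₁ p)) → b p ; (inj₂ (inj₂ p)) → c p }

      indep : ∀ a b → T a → T b → adj G a b ≡ false
      indep a b (inj₁ refl) (inj₁ refl) = adj-irr G a
      indep a b (inj₁ refl) (inj₂ (inj₁ refl)) = auv
      indep a b (inj₁ refl) (inj₂ (inj₂ refl)) = auw
      indep a b (inj₂ (inj₁ refl)) (inj₁ refl) = trans (adj-sym G a b) auv
      indep a b (inj₂ (inj₁ refl)) (inj₂ (inj₁ refl)) = adj-irr G a
      indep a b (inj₂ (inj₁ refl)) (inj₂ (inj₂ refl)) = avw
      indep a b (inj₂ (inj₂ refl)) (inj₁ refl) = trans (adj-sym G a b) auw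
      indep a b (inj₂ (inj₂ refl)) (inj₂ (inj₁ refl)) = trans (adj-sym G a b) avw
      indep a b (inj₂ (inj₂ refl)) (inj₂ (inj₂ refl)) = adj-irr G a

      m1 = merge u v uv
      neq : m1 u ≢ m1 w
      neq e with merge-kernel u v uv u w e
      ... | inj₁ p = uw p
      ... | inj₂ (_ , inj₁ p) = uw (sym p)
      ... | inj₂ (_ , inj₂ p) = vw (sym p)
      f : Fin (suc (suc k)) → Fin k
      f x = merge (m1 u) (m1 w) neq (m1 x)

      toT : ∀ x → OneOf (m1 u) (m1 w) (m1 x) → T x
      toT x (inj₁ e) with merge-kernel u v uv x u e
      ... | inj₁ p = inj₁ p
      ... | inj₂ (inj₁ p , _) = inj₁ p
      ... | inj₂ (inj₂ p , _) = inj₂ (inj₁ p)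
      toT x (inj₂ e) with merge-kernel u v uv x w e
      ... | inj₁ p = inj₂ (inj₂ p)
      ... | inj₂ (_ , inj₁ p) = ⊥-elim (uw (sym p))
      ... | inj₂ (_ , inj₂ p) = ⊥-elim (vw (sym p))

      ker : ∀ x y → f x ≡ f y → x ≡ y ⊎ (T x × T y)
      ker x y e with merge-kernel (m1 u) (m1 w) neq (m1 x) (m1 y) e
      ... | inj₂ (hx , hy) = inj₂ (toT x hx , toT y hy)
      ... | inj₁ e' with merge-kernel u v uv x y e'
      ... | inj₁ p = inj₁ p
      ... | inj₂ (hx , hy) = inj₂ ([ inj₁ , (λ p → inj₂ (inj₁ p)) ]′ hx , [ inj₁ , (λ p → inj₂ (inj₁ p)) ]′ hy)

      pr : Proper G f
      pr x y a e with ker x y e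
      ... | inj₁ refl = false≢true (trans (sym (adj-irr G x)) a)
      ... | inj₂ (tx , ty) = false≢true (trans (sym (indep x y tx ty)) a)

      match : ∀ a b → T a → T b → a ≢ b → Twins G a b → Twins G u v ⊎ Twins G u w ⊎ Twins G v w
      match a b (inj₁ refl) (inj₁ refl) ne _ = ⊥-elim (ne refl)
      match a b (inj₁ refl) (inj₂ (inj₁ refl)) ne t = inj₁ t
      match a b (inj₁ refl) (inj₂ (inj₂ refl)) ne t = inj₂ (inj₁ t)
      match a b (inj₂ (inj₁ refl)) (inj₁ refl) ne t = inj₁ (twins-sym {G = G} t)
      match a b (inj₂ (inj₁ refl)) (inj₂ (inj₁ refl)) ne _ = ⊥-elim (ne refl)
      match a b (inj₂ (inj₁ refl)) (inj₂ (inj₂ refl)) ne t = inj₂ (inj₂ t)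
      match a b (inj₂ (inj₂ refl)) (inj₁ refl) ne t = inj₂ (inj₁ (twins-sym {G = G} t))
      match a b (inj₂ (inj₂ refl)) (inj₂ (inj₁ refl)) ne t = inj₂ (inj₂ (twins-sym {G = G} t))
      match a b (inj₂ (inj₂ refl)) (inj₂ (inj₂ refl)) ne _ = ⊥-elim (ne refl)

    independent-triple-twins : Twins G u v ⊎ Twins G u w ⊎ Twins G v w
    independent-triple-twins with twins? G u v | twins? G u w | twins? G v w
    ... | yes t | _ | _ = inj₁ t
    ... | no _ | yes t | _ = inj₂ (inj₁ t)
    ... | no _ | no _ | yes t = inj₂ (inj₂ t)
    ... | no n1 | no n2 | no n3 = ⊥-elim (no-smaller-distinguishing pr di)
      where
      di : Distinguishing G f
      di σ h i with ker (to σ i) i (h i)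
      ... | inj₁ p = p
      ... | inj₂ (tσ , ti) with to σ i ≟ i
      ... | yes p = p
      ... | no ne = ⊥-elim (contra (match i (to σ i) ti tσ (λ e → ne (sym e)) tw))
        where
        contra : Twins G u v ⊎ Twins G u w ⊎ Twins G v w → ⊥
        contra (inj₁ t) = n1 t
        contra (inj₂ (inj₁ t)) = n2 t
        contra (inj₂ (inj₂ t)) = n3 t
        tw : Twins G i (to σ i)
        tw z with T? z
        ... | yes tz = trans (indep i z ti tz) (sym (indep (to σ i) z tσ tz))
        ... | no ntz with ker (to σ z) z (h z)
        ... | inj₂ (_ , tz) = ⊥-elim (ntz tz)
        ... | inj₁ p = trans (sym (preserves σ i z)) (cong (adj G (to σ i)) p)

  swap-preserving⇒twins : ∀ u v → adj G u v ≡ false → (∀ a b → adj G (swap u v a) (swap u v b) ≡ adj G a b) → Twins G u v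
  swap-preserving⇒twins u v auv pres z with swap-view u v z
  ... | isU p e rewrite p = trans (adj-irr G u) (sym (trans (adj-sym G v u) auv))
  ... | isV _ p e rewrite p = trans auv (sym (adj-irr G v))
  ... | isO _ _ e = trans (sym (pres u z)) (cong₂ (adj G) (swap-u u v) e)

  -- As above, merging {u, v} and {x, y}: a colour-preserving automorphism can only be the
  -- identity, one of the two swaps or their product.
  module _ (u v x y : Fin (suc (suc k))) (uv : u ≢ v) (xy : x ≢ y) (xu : x ≢ u) (xv : x ≢ v) (yu : y ≢ u) (yv : y ≢ v)
           (auv : adj G u v ≡ false) (axy : adj G x y ≡ false) where
    doubleSwap : Fin (suc (suc k)) → Fin (suc (suc k))
    doubleSwap a = swap u v (swap x y a)

    DoubleSwapAut : Set
    DoubleSwapAut = ∀ a b → adj G (doubleSwap a) (doubleSwap b) ≡ adj G a b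

    private
      P Q : Fin (suc (suc k)) → Set
      P = OneOf u v
      Q = OneOf x y

      m1 = merge u v uv
      neq : m1 x ≢ m1 y
      neq e with merge-kernel u v uv x y e
      ... | inj₁ p = xy p
      ... | inj₂ (inj₁ p , _) = xu p
      ... | inj₂ (inj₂ p , _) = xv p
      f : Fin (suc (suc k)) → Fin k
      f a = merge (m1 x) (m1 y) neq (m1 a)

      toQ : ∀ a → OneOf (m1 x) (m1 y) (m1 a) → Q a
      toQ a (inj₁ e) with merge-kernel u v uv a x e
      ... | inj₁ p = inj₁ p
      ... | inj₂ (_ , inj₁ p) = ⊥-elim (xu p)
      ... | inj₂ (_ , inj₂ p) = ⊥-elim (xv p)
      toQ a (inj₂ e) with merge-kernel u v uv a y e
      ... | inj₁ p = inj₂ p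
      ... | inj₂ (_ , inj₁ p) = ⊥-elim (yu p)
      ... | inj₂ (_ , inj₂ p) = ⊥-elim (yv p)

      ker : ∀ a b → f a ≡ f b → a ≡ b ⊎ (P a × P b) ⊎ (Q a × Q b)
      ker a b e with merge-kernel (m1 x) (m1 y) neq (m1 a) (m1 b) e
      ... | inj₂ (ha , hb) = inj₂ (inj₂ (toQ a ha , toQ b hb))
      ... | inj₁ e' with merge-kernel u v uv a b e'
      ... | inj₁ p = inj₁ p
      ... | inj₂ pp = inj₂ (inj₁ pp)

      pair-nonadjacent : ∀ {s t} → adj G s t ≡ false → ∀ a b → OneOf s t a → OneOf s t b → adj G a b ≡ false
      pair-nonadjacent h a b (inj₁ refl) (inj₁ refl) = adj-irr G a
      pair-nonadjacent h a b (inj₁ refl) (inj₂ refl) = h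
      pair-nonadjacent h a b (inj₂ refl) (inj₁ refl) = trans (adj-sym G a b) h
      pair-nonadjacent h a b (inj₂ refl) (inj₂ refl) = adj-irr G a

      pr : Proper G f
      pr a b ad e with ker a b e
      ... | inj₁ refl = false≢true (trans (sym (adj-irr G a)) ad)
      ... | inj₂ (inj₁ (pa , pb)) = false≢true (trans (sym (pair-nonadjacent auv a b pa pb)) ad)
      ... | inj₂ (inj₂ (qa , qb)) = false≢true (trans (sym (pair-nonadjacent axy a b qa qb)) ad)

    private
      module ColourPreserving (σ : Aut G) (h : ∀ a → f (to σ a) ≡ f a) where
        s = to σ
        inj : ∀ {a b} → s a ≡ s b → a ≡ b
        inj = to-injective σ
        fixO : ∀ a → ¬ P a → ¬ Q a → s a ≡ a
        fixO a np nq with ker (s a) a (h a)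
        ... | inj₁ p = p
        ... | inj₂ (inj₁ (_ , pa)) = ⊥-elim (np pa)
        ... | inj₂ (inj₂ (_ , qa)) = ⊥-elim (nq qa)
        inP : ∀ a → P a → P (s a)
        inP a pa with ker (s a) a (h a)
        ... | inj₁ p = subst P (sym p) pa
        ... | inj₂ (inj₁ (ps , _)) = ps
        ... | inj₂ (inj₂ (_ , inj₁ refl)) = ⊥-elim ([ xu , xv ]′ pa)
        ... | inj₂ (inj₂ (_ , inj₂ refl)) = ⊥-elim ([ yu , yv ]′ pa)
        inQ : ∀ a → Q a → Q (s a)
        inQ a qa with ker (s a) a (h a)
        ... | inj₁ p = subst Q (sym p) qa
        ... | inj₂ (inj₂ (qs , _)) = qs
        ... | inj₂ (inj₁ (_ , inj₁ refl)) = ⊥-elim ([ (λ e → xu (sym e)) , (λ e → yu (sym e)) ]′ qa)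
        ... | inj₂ (inj₁ (_ , inj₂ refl)) = ⊥-elim ([ (λ e → xv (sym e)) , (λ e → yv (sym e)) ]′ qa)
        agree : (E : Fin (suc (suc k)) → Fin (suc (suc k))) → E u ≡ s u → E v ≡ s v → E x ≡ s x → E y ≡ s y
              → (∀ a → ¬ P a → ¬ Q a → E a ≡ a) → ∀ a → s a ≡ E a
        agree E eu ev ex ey eo a with a ≟ u | a ≟ v | a ≟ x | a ≟ y
        ... | yes refl | _ | _ | _ = sym eu
        ... | no _ | yes refl | _ | _ = sym ev
        ... | no _ | no _ | yes refl | _ = sym ex
        ... | no _ | no _ | no _ | yes refl = sym ey
        ... | no a1 | no a2 | no a3 | no a4 = trans (fixO a np nq) (sym (eo a np nq))
          where
          np : ¬ P a
          np = [ a1 , a2 ]′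
          nq : ¬ Q a
          nq = [ a3 , a4 ]′
        presE : (E : Fin (suc (suc k)) → Fin (suc (suc k))) → (∀ a → s a ≡ E a) → ∀ a b → adj G (E a) (E b) ≡ adj G a b
        presE E ag a b = trans (sym (cong₂ (adj G) (ag a) (ag b))) (preserves σ a b)
        swap-outside : ∀ {p q : Fin (suc (suc k))} a → ¬ OneOf p q a → swap p q a ≡ a
        swap-outside {p} {q} a n = swap-other p q a (λ e → n (inj₁ e)) (λ e → n (inj₂ e))
        uvx = swap-other u v x xu xv
        uvy = swap-other u v y yu yv
        xyu = swap-other x y u (λ e → xu (sym e)) (λ e → yu (sym e))
        xyv = swap-other x y v (λ e → xv (sym e)) (λ e → yv (sym e))
        caseU : s u ≡ u × s v ≡ v ⊎ s u ≡ v × s v ≡ u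
        caseU with inP u (inj₁ refl) | inP v (inj₂ refl)
        ... | inj₁ p | inj₁ q = ⊥-elim (uv (inj (trans p (sym q))))
        ... | inj₁ p | inj₂ q = inj₁ (p , q)
        ... | inj₂ p | inj₁ q = inj₂ (p , q)
        ... | inj₂ p | inj₂ q = ⊥-elim (uv (inj (trans p (sym q))))
        caseX : s x ≡ x × s y ≡ y ⊎ s x ≡ y × s y ≡ x
        caseX with inQ x (inj₁ refl) | inQ y (inj₂ refl)
        ... | inj₁ p | inj₁ q = ⊥-elim (xy (inj (trans p (sym q))))
        ... | inj₁ p | inj₂ q = inj₁ (p , q)
        ... | inj₂ p | inj₁ q = inj₂ (p , q)
        ... | inj₂ p | inj₂ q = ⊥-elim (xy (inj (trans p (sym q))))
        trichotomy : (∀ a → s a ≡ a) ⊎ Twins G u v ⊎ Twins G x y ⊎ DoubleSwapAut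
        trichotomy with caseU | caseX
        ... | inj₁ (p1 , p2) | inj₁ (q1 , q2) = inj₁ (agree id (sym p1) (sym p2) (sym q1) (sym q2) (λ _ _ _ → refl))
        ... | inj₂ (p1 , p2) | inj₁ (q1 , q2) = inj₂ (inj₁ (swap-preserving⇒twins u v auv (presE (swap u v)
                (agree (swap u v) (trans (swap-u u v) (sym p1)) (trans (swap-v u v) (sym p2)) (trans uvx (sym q1)) (trans uvy (sym q2))
                   (λ a np nq → swap-outside a np)))))
        ... | inj₁ (p1 , p2) | inj₂ (q1 , q2) = inj₂ (inj₂ (inj₁ (swap-preserving⇒twins x y axy (presE (swap x y)
                (agree (swap x y) (trans xyu (sym p1)) (trans xyv (sym p2)) (trans (swap-u x y) (sym q1)) (trans (swap-v x y) (sym q2))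
                   (λ a np nq → swap-outside a nq))))))
        ... | inj₂ (p1 , p2) | inj₂ (q1 , q2) = inj₂ (inj₂ (inj₂ (presE doubleSwap
                (agree doubleSwap (trans (cong (swap u v) xyu) (trans (swap-u u v) (sym p1)))
                          (trans (cong (swap u v) xyv) (trans (swap-v u v) (sym p2)))
                          (trans (cong (swap u v) (swap-u x y)) (trans uvy (sym q1)))
                          (trans (cong (swap u v) (swap-v x y)) (trans uvx (sym q2)))
                          (λ a np nq → trans (cong (swap u v) (swap-outside a nq)) (swap-outside a np))))))

    nonedge-pairs-twins : Twins G u v ⊎ Twins G x y ⊎ DoubleSwapAut
    nonedge-pairs-twins with twins? G u v | twins? G x y | all? (λ a → all? (λ b → adj G (doubleSwap a) (doubleSwap b) ≟B adj G a b))
    ... | yes t | _ | _ = inj₁ t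
    ... | no _ | yes t | _ = inj₂ (inj₁ t)
    ... | no _ | no _ | yes t = inj₂ (inj₂ t)
    ... | no n1 | no n2 | no n3 = ⊥-elim (no-smaller-distinguishing pr di)
      where
      di : Distinguishing G f
      di σ h with ColourPreserving.trichotomy σ h
      ... | inj₁ fixed = fixed
      ... | inj₂ (inj₁ t) = ⊥-elim (n1 t)
      ... | inj₂ (inj₂ (inj₁ t)) = ⊥-elim (n2 t)
      ... | inj₂ (inj₂ (inj₂ d)) = ⊥-elim (n3 d)

-- Bad vertices

Bad : ∀ {n} → Graph n → Fin n → Fin n → Set
Bad G u v = u ≢ v × adj G u v ≡ false × ¬ Twins G u v

bad? : ∀ {n} (G : Graph n) u v → Dec (Bad G u v)
bad? G u v = ¬? (u ≟ v) ×-dec (adj G u v ≟B false) ×-dec ¬? (twins? G u v)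

bad-sym : ∀ {n} (G : Graph n) {u v} → Bad G u v → Bad G v u
bad-sym G {u} {v} (a , b , c) = (λ e → a (sym e)) , trans (adj-sym G v u) b , (λ t → c (twins-sym {G = G} t))

BadVertex : ∀ {n} → Graph n → Fin n → Set
BadVertex G x = ∃ λ y → Bad G x y

badVertex? : ∀ {n} (G : Graph n) x → Dec (BadVertex G x)
badVertex? G x = any? (λ y → bad? G x y)

AvoidsBad : ∀ {n} → Graph n → Fin n → Set
AvoidsBad G z = ∀ b → BadVertex G b → adj G z b ≡ false

avoidsBad? : ∀ {n} (G : Graph n) z → Dec (AvoidsBad G z)
avoidsBad? G z = all? (λ b → badVertex? G b →-dec (adj G z b ≟B false))

record BadIs2K₂ {n} (G : Graph n) : Set where
  field
    u w v q : Fin n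
    Bu : BadVertex G u
    Bw : BadVertex G w
    Bv : BadVertex G v
    Bq : BadVertex G q
    uw : adj G u w ≡ true
    vq : adj G v q ≡ true
    uv : adj G u v ≡ false
    uq : adj G u q ≡ false
    wv : adj G w v ≡ false
    wq : adj G w q ≡ false
    onlyB : ∀ x → BadVertex G x → x ≡ u ⊎ x ≡ w ⊎ x ≡ v ⊎ x ≡ q

record BadIsHK₁ {n} (G : Graph n) : Set where
  field
    z : Fin n
    Bz : BadVertex G z
    Iz : AvoidsBad G z
    twB : ∀ b c → BadVertex G b → BadVertex G c → b ≢ z → c ≢ z → b ≢ c → adj G b c ≡ false → Twins G b c
    e1 e2 : Fin n
    Be1 : BadVertex G e1
    Be2 : BadVertex G e2
    e1z : e1 ≢ z
    e2z : e2 ≢ z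
    e12 : adj G e1 e2 ≡ true

module BadStructure {k : ℕ} (G : Graph (suc (suc k))) (hχ : IsχD G (suc k)) where
  open Extremal G hχ
  V = Fin (suc (suc k))

  good-adj-bad : ∀ m b → ¬ BadVertex G m → BadVertex G b → adj G m b ≡ true
  good-adj-bad m b nm (b' , bb' , abb' , ntbb') with adj G m b in amb
  ... | true = refl
  ... | false with m ≟ b
  ... | yes refl = ⊥-elim (nm (b' , bb' , abb' , ntbb'))
  ... | no mb with twins? G m b
  ... | no nt = ⊥-elim (nm (b , mb , amb , nt))
  ... | yes t with m ≟ b'
  ... | yes refl = ⊥-elim (nm (b , bad-sym G (bb' , abb' , ntbb')))
  ... | no mb' with twins? G m b'
  ... | yes t' = ⊥-elim (ntbb' (twins-trans {G = G} (twins-sym {G = G} t) t'))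
  ... | no nt' = ⊥-elim (nm (b' , mb' , trans (t b') abb' , nt'))

  good-nonadj⇒twins : ∀ m m' → ¬ BadVertex G m → m ≢ m' → adj G m m' ≡ false → Twins G m m'
  good-nonadj⇒twins m m' nm ne a with twins? G m m'
  ... | yes t = t
  ... | no nt = ⊥-elim (nm (m' , ne , a , nt))

  opaque
   bad-neighbour : ∀ z → ¬ AvoidsBad G z → ∃ λ c → BadVertex G c × adj G z c ≡ true
   bad-neighbour z ni with ¬∀⟶∃¬ _ _ (λ b → badVertex? G b →-dec (adj G z b ≟B false)) ni
   ... | c , nc with badVertex? G c
   ... | no nb = ⊥-elim (nc (λ b → ⊥-elim (nb b)))
   ... | yes bc with adj G z c in e
   ... | true = c , bc , e
   ... | false = ⊥-elim (nc (λ _ → refl))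

  avoiders-twins : ∀ z b → BadVertex G z → BadVertex G b → AvoidsBad G z → AvoidsBad G b → Twins G z b
  avoiders-twins z b bz bb iz ib w with badVertex? G w
  ... | yes bw = trans (iz w bw) (sym (ib w bw))
  ... | no nw = trans (adj-true-sym G (good-adj-bad w z nw bz)) (sym (adj-true-sym G (good-adj-bad w b nw bb)))

  avoider-unique : ∀ z z' → BadVertex G z → BadVertex G z' → AvoidsBad G z → AvoidsBad G z' → z ≢ z' → ⊥
  avoider-unique z z' bz bz' iz iz' zz' with bz
  ... | b , (zb , azb , ntzb) with avoidsBad? G b
  ... | yes ib = ntzb (avoiders-twins z b bz (z , bad-sym G (zb , azb , ntzb)) iz ib)
  ... | no nib with bad-neighbour b nib
  ... | c , bc , abc = res (nonedge-pairs-twins z b z' c zb z'c (≢-sym zz') z'b cz cb azb (iz' c bc))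
    where
    Bb : BadVertex G b
    Bb = z , bad-sym G (zb , azb , ntzb)
    cz : c ≢ z
    cz refl = true≢false (trans (sym (adj-true-sym G abc)) (iz b Bb))
    z'c : z' ≢ c
    z'c refl = true≢false (trans (sym (adj-true-sym G abc)) (iz' b Bb))
    z'b : z' ≢ b
    z'b refl = true≢false (trans (sym abc) (iz' c bc))
    cb : c ≢ b
    cb e = adj⇒≢ G abc (sym e)
    res : Twins G z b ⊎ Twins G z' c ⊎ DoubleSwapAut z b z' c zb z'c (≢-sym zz') z'b cz cb azb (iz' c bc) → ⊥
    res (inj₁ t) = ntzb t
    res (inj₂ (inj₁ t)) = true≢false (trans (sym (adj-true-sym G abc)) (trans (sym (t b)) (iz' b Bb)))
    res (inj₂ (inj₂ ds)) = true≢false (trans (sym abc) (trans (sym (ds b c)) (trans (cong₂ (adj G) e1 e2) (iz z' bz'))))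
      where
      e1 : swap z b (swap z' c b) ≡ z
      e1 = trans (cong (swap z b) (swap-other z' c b (λ e → z'b (sym e)) (λ e → cb (sym e)))) (swap-v z b)
      e2 : swap z b (swap z' c c) ≡ z'
      e2 = trans (cong (swap z b) (swap-v z' c)) (swap-other z b z' (≢-sym zz') z'b)

  others-not-avoiders : ∀ z → BadVertex G z → AvoidsBad G z → ∀ b → BadVertex G b → b ≢ z → ¬ AvoidsBad G b
  others-not-avoiders z bz iz b bb bz' ib = avoider-unique z b bz bb iz ib (≢-sym bz')

  bad-nonadj⇒twins : ∀ z → BadVertex G z → AvoidsBad G z → ∀ b c → BadVertex G b → BadVertex G c → b ≢ z → c ≢ z → b ≢ c → adj G b c ≡ false → Twins G b c
  bad-nonadj⇒twins z bz iz b c bb bc bz' cz' bc' abc with bad-neighbour b (others-not-avoiders z bz iz b bb bz') | bad-neighbour c (others-not-avoiders z bz iz c bc cz')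
  ... | b1 , bb1 , ab1 | c1 , bc1 , ac1 with independent-triple-twins z b c (≢-sym bz') (≢-sym cz') bc' (iz b bb) (iz c bc) abc
  ... | inj₁ t = ⊥-elim (true≢false (trans (sym ab1) (trans (sym (t b1)) (iz b1 bb1))))
  ... | inj₂ (inj₁ t) = ⊥-elim (true≢false (trans (sym ac1) (trans (sym (t c1)) (iz c1 bc1))))
  ... | inj₂ (inj₂ t) = t

  avoiderCase : ∀ z → BadVertex G z → AvoidsBad G z → BadIsHK₁ G
  avoiderCase z bz iz with bz
  ... | b , bd with bad-neighbour b (others-not-avoiders z bz iz b (z , bad-sym G bd) (λ e → proj₁ bd (sym e)))
  ... | c , bc , abc = record { z = z ; Bz = bz ; Iz = iz ; twB = bad-nonadj⇒twins z bz iz ; e1 = b ; e2 = c ; Be1 = Bb ; Be2 = bc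
                         ; e1z = λ e → proj₁ bd (sym e) ; e2z = cz ; e12 = abc }
    where
    Bb : BadVertex G b
    Bb = z , bad-sym G bd
    cz : c ≢ z
    cz e = true≢false (trans (sym (adj-true-sym G abc)) (trans (cong (λ t → adj G t b) e) (iz b Bb)))

  module TwoEdgeCase (u v w : V) (bd : Bad G u v) (auw : adj G u w ≡ true) (avw : adj G v w ≡ false)
              (noIso : ∀ z → BadVertex G z → ¬ AvoidsBad G z) where
    uv' = proj₁ bd
    auv = proj₁ (proj₂ bd)
    ntuv = proj₂ (proj₂ bd)
    Bu : BadVertex G u
    Bu = v , bd
    Bv : BadVertex G v
    Bv = u , bad-sym G bd
    wu : w ≢ u
    wu e = adj⇒≢ G auw (sym e)
    wv : w ≢ v
    wv = adj-nonadj⇒≢ G auw auv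
    Bw : BadVertex G w
    Bw = v , bad-sym G (≢-sym wv , avw , not-twins G u (λ e → true≢false (trans (sym (adj-true-sym G auw)) (trans (sym e) (adj-false-sym G auv)))))
    nbv = bad-neighbour v (noIso v Bv)
    q = proj₁ nbv
    Bq = proj₁ (proj₂ nbv)
    avq = proj₂ (proj₂ nbv)
    qu : q ≢ u
    qu e = adj-nonadj⇒≢ G avq (adj-false-sym G auv) e
    qw : q ≢ w
    qw = adj-nonadj⇒≢ G avq avw
    qv : q ≢ v
    qv e = adj⇒≢ G avq (sym e)

    w≁q : adj G w q ≡ false
    w≁q with adj G w q in awq
    ... | false = refl
    ... | true with adj G u q in auq
    ...   | false = ⊥-elim (res (nonedge-pairs-twins u q v w (≢-sym qu) (≢-sym wv) (≢-sym uv') (≢-sym qv) wu (≢-sym qw) auq avw))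
      where
      res : Twins G u q ⊎ Twins G v w ⊎ DoubleSwapAut u q v w (≢-sym qu) (≢-sym wv) (≢-sym uv') (≢-sym qv) wu (≢-sym qw) auq avw → ⊥
      res (inj₁ t) = true≢false (trans (sym avq) (trans (adj-sym G v q) (trans (sym (t v)) (trans (adj-sym G u v) (adj-false-sym G auv)))))
      res (inj₂ (inj₁ t)) = true≢false (trans (sym auw) (trans (adj-sym G u w) (trans (sym (t u)) (trans (adj-sym G v u) auv))))
      res (inj₂ (inj₂ ds)) = true≢false (trans (sym awq) (trans (adj-sym G w q) (trans (sym (cong₂ (adj G) e1 e2)) (trans (ds u v) auv))))
        where
        e1 : swap u q (swap v w u) ≡ q
        e1 = trans (cong (swap u q) (swap-other v w u uv' (≢-sym wu))) (swap-u u q)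
        e2 : swap u q (swap v w v) ≡ w
        e2 = trans (cong (swap u q) (swap-u v w)) (swap-other u q w wu (≢-sym qw))
    ...   | true with Bq
    ...     | r , qr , aqr , ntqr = ⊥-elim (res (nonedge-pairs-twins u v q r uv' qr qu qv ru rv auv aqr))
      where
      ru : r ≢ u
      ru e = adj-nonadj⇒≢ G (adj-true-sym G auq) aqr (sym e)
      rv : r ≢ v
      rv e = adj-nonadj⇒≢ G (adj-true-sym G avq) aqr (sym e)
      rw : r ≢ w
      rw e = adj-nonadj⇒≢ G (adj-true-sym G awq) aqr (sym e)
      res : Twins G u v ⊎ Twins G q r ⊎ DoubleSwapAut u v q r uv' qr qu qv ru rv auv aqr → ⊥
      res (inj₁ t) = ntuv t
      res (inj₂ (inj₁ t)) = ntqr t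
      res (inj₂ (inj₂ ds)) = true≢false (trans (sym auw) (trans (sym (ds u w)) (trans (cong₂ (adj G) e1 e2) avw)))
        where
        e1 : swap u v (swap q r u) ≡ v
        e1 = trans (cong (swap u v) (swap-other q r u (≢-sym qu) (≢-sym ru))) (swap-u u v)
        e2 : swap u v (swap q r w) ≡ w
        e2 = trans (cong (swap u v) (swap-other q r w (≢-sym qw) (≢-sym rw))) (swap-other u v w wu wv)

    ntwq : ¬ Twins G w q
    ntwq t = true≢false (trans (sym avq) (trans (adj-sym G v q) (trans (sym (t v)) (trans (adj-sym G w v) avw))))
    ds : DoubleSwapAut u v w q uv' (≢-sym qw) wu wv qu qv auv w≁q
    ds with nonedge-pairs-twins u v w q uv' (≢-sym qw) wu wv qu qv auv w≁q
    ... | inj₁ t = ⊥-elim (ntuv t)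
    ... | inj₂ (inj₁ t) = ⊥-elim (ntwq t)
    ... | inj₂ (inj₂ d) = d
    du : swap u v (swap w q u) ≡ v
    du = trans (cong (swap u v) (swap-other w q u (≢-sym wu) (≢-sym qu))) (swap-u u v)
    dq : swap u v (swap w q q) ≡ w
    dq = trans (cong (swap u v) (swap-v w q)) (swap-other u v w wu wv)
    dw : swap u v (swap w q w) ≡ q
    dw = trans (cong (swap u v) (swap-u w q)) (swap-other u v q qu qv)
    auq : adj G u q ≡ false
    auq = trans (sym (ds u q)) (trans (cong₂ (adj G) du dq) avw)
    dz : ∀ z → z ≢ u → z ≢ v → z ≢ w → z ≢ q → swap u v (swap w q z) ≡ z
    dz z zu zv zw zq = trans (cong (swap u v) (swap-other w q z zw zq)) (swap-other u v z zu zv)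
    -- Another bad vertex x would be adjacent to u and w, and by the double swap to v and q; a bad
    -- partner y of x then makes {u, q}, {x, y} violate nonedge-pairs-twins.
    onlyB : ∀ x → BadVertex G x → x ≡ u ⊎ x ≡ w ⊎ x ≡ v ⊎ x ≡ q
    onlyB x bx with x ≟ u | x ≟ w | x ≟ v | x ≟ q
    ... | yes p | _ | _ | _ = inj₁ p
    ... | no _ | yes p | _ | _ = inj₂ (inj₁ p)
    ... | no _ | no _ | yes p | _ = inj₂ (inj₂ (inj₁ p))
    ... | no _ | no _ | no _ | yes p = inj₂ (inj₂ (inj₂ p))
    ... | no xu | no xw | no xv | no xq = ⊥-elim (fin bx)
      where
      hu : adj G v x ≡ adj G u x
      hu = trans (sym (cong₂ (adj G) du (dz x xu xv xw xq))) (ds u x)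
      hw : adj G q x ≡ adj G w x
      hw = trans (sym (cong₂ (adj G) dw (dz x xu xv xw xq))) (ds w x)
      xux : adj G x u ≡ adj G x v
      xux = trans (adj-sym G x u) (trans (sym hu) (adj-sym G v x))
      xwx : adj G x w ≡ adj G x q
      xwx = trans (adj-sym G x w) (trans (sym hw) (adj-sym G q x))
      axu : adj G u x ≡ true
      axu with adj G u x in aux
      ... | true = refl
      ... | false with independent-triple-twins u v x uv' (≢-sym xu) (≢-sym xv) auv aux (trans hu aux)
      ... | inj₁ t = ⊥-elim (ntuv t)
      ... | inj₂ (inj₁ t) = ⊥-elim (true≢false (trans (sym auw) (trans (t w) (trans xwx (trans (sym (t q)) auq)))))
      ... | inj₂ (inj₂ t) = ⊥-elim (true≢false (trans (sym avq) (trans (t q) (trans (sym xwx) (trans (sym (t w)) avw)))))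
      axw : adj G w x ≡ true
      axw with adj G w x in awx
      ... | true = refl
      ... | false with independent-triple-twins w q x (≢-sym qw) (≢-sym xw) (≢-sym xq) w≁q awx (trans hw awx)
      ... | inj₁ t = ⊥-elim (ntwq t)
      ... | inj₂ (inj₁ t) = ⊥-elim (true≢false (trans (sym (adj-true-sym G auw)) (trans (t u) (trans xux (trans (sym (t v)) (trans (adj-sym G w v) avw))))))
      ... | inj₂ (inj₂ t) = ⊥-elim (true≢false (trans (sym avq) (trans (adj-sym G v q) (trans (t v) (trans (sym xux) (trans (sym (t u)) (trans (adj-sym G q u) auq)))))))
      fin : BadVertex G x → ⊥
      fin (y , xy , axy , ntxy) = res (nonedge-pairs-twins u q x y (≢-sym qu) xy xu xq yu yq auq axy)
        where
        yu : y ≢ u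
        yu e = adj-nonadj⇒≢ G (adj-true-sym G axu) axy (sym e)
        yq : y ≢ q
        yq e = adj-nonadj⇒≢ G (adj-true-sym G (trans hw axw)) axy (sym e)
        yw : y ≢ w
        yw e = adj-nonadj⇒≢ G (adj-true-sym G axw) axy (sym e)
        res : Twins G u q ⊎ Twins G x y ⊎ DoubleSwapAut u q x y (≢-sym qu) xy xu xq yu yq auq axy → ⊥
        res (inj₁ t) = true≢false (trans (sym auw) (trans (t w) (trans (adj-sym G q w) w≁q)))
        res (inj₂ (inj₁ t)) = ntxy t
        res (inj₂ (inj₂ d)) = true≢false (trans (sym auw) (trans (sym (d u w)) (trans (cong₂ (adj G) e1 e2) (trans (adj-sym G q w) w≁q))))
          where
          e1 : swap u q (swap x y u) ≡ q
          e1 = trans (cong (swap u q) (swap-other x y u (≢-sym xu) (≢-sym yu))) (swap-u u q)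
          e2 : swap u q (swap x y w) ≡ w
          e2 = trans (cong (swap u q) (swap-other x y w (≢-sym xw) (≢-sym yw))) (swap-other u q w wu (≢-sym qw))

    result : BadIs2K₂ G
    result = record { u = u ; w = w ; v = v ; q = q ; Bu = Bu ; Bw = Bw ; Bv = Bv ; Bq = Bq
        ; uw = auw ; vq = avq ; uv = auv ; uq = auq ; wv = trans (adj-sym G w v) avw ; wq = w≁q ; onlyB = onlyB }


  -- Either some bad vertex is non-adjacent to all bad vertices, or there is a bad pair u v and a
  -- vertex w adjacent to exactly one of them; then nonedge-pairs-twins pins down all bad vertices.
  classify : BadIs2K₂ G ⊎ BadIsHK₁ G
  classify with any? (λ z → badVertex? G z ×-dec avoidsBad? G z)
  ... | yes (z , bz , iz) = inj₂ (avoiderCase z bz iz)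
  ... | no ni with nontwin-nonedge
  ... | u , v , uv , auv , ntuv with ¬∀⟶∃¬ _ _ (λ w → adj G u w ≟B adj G v w) ntuv
  ... | w , nw with adj G u w in e1 | adj G v w in e2
  ... | true | true = ⊥-elim (nw refl)
  ... | false | false = ⊥-elim (nw refl)
  ... | true | false = inj₁ (TwoEdgeCase.result u v w (uv , auv , ntuv) e1 e2 (λ z bz iz → ni (z , bz , iz)))
  ... | false | true = inj₁ (TwoEdgeCase.result v u w (bad-sym G (uv , auv , ntuv)) e2 e1 (λ z bz iz → ni (z , bz , iz)))

-- The decomposition G ≅ M ∨ X

record Partition {n : ℕ} (P : Fin n → Set) : Set where
  field
    a b : ℕ
    eL : Fin a → Fin n
    eR : Fin b → Fin n
    back : Fin n → Fin a ⊎ Fin b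
    pL : ∀ i → P (eL i)
    pR : ∀ j → ¬ P (eR j)
    bL : ∀ i → back (eL i) ≡ inj₁ i
    bR : ∀ j → back (eR j) ≡ inj₂ j
    eb : ∀ x → [ eL , eR ]′ (back x) ≡ x

  eL-inj : ∀ {i j} → eL i ≡ eL j → i ≡ j
  eL-inj {i} {j} e with trans (sym (bL i)) (trans (cong back e) (bL j))
  ... | refl = refl

  eR-inj : ∀ {i j} → eR i ≡ eR j → i ≡ j
  eR-inj {i} {j} e with trans (sym (bR i)) (trans (cong back e) (bR j))
  ... | refl = refl

  findL : ∀ x → P x → Σ (Fin a) λ i → eL i ≡ x
  findL x px with back x | eb x
  ... | inj₁ i | q = i , q
  ... | inj₂ j | q = ⊥-elim (pR j (subst P (sym q) px))

  findR : ∀ x → ¬ P x → Σ (Fin b) λ j → eR j ≡ x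
  findR x npx with back x | eb x
  ... | inj₁ i | q = ⊥-elim (npx (subst P q (pL i)))
  ... | inj₂ j | q = j , q

partition : ∀ {n} {P : Fin n → Set} → (∀ x → Dec (P x)) → Partition P
partition {zero} P? = record { a = 0 ; b = 0 ; eL = λ () ; eR = λ () ; back = λ () ; pL = λ () ; pR = λ () ; bL = λ () ; bR = λ () ; eb = λ () }
partition {suc n} {P} P? with partition (λ x → P? (suc x)) | P? zero
... | E | yes p0 = record { a = suc a ; b = b ; eL = eL' ; eR = λ j → suc (eR j) ; back = back'
    ; pL = pL' ; pR = pR ; bL = bL' ; bR = λ j → cong (Sum.map₁ suc) (bR j) ; eb = eb' }
  where
  open Partition E
  eL' : Fin (suc a) → Fin (suc n)
  eL' zero = zero
  eL' (suc i) = suc (eL i)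
  back' : Fin (suc n) → Fin (suc a) ⊎ Fin b
  back' zero = inj₁ zero
  back' (suc x) = Sum.map₁ suc (back x)
  pL' : ∀ i → P (eL' i)
  pL' zero = p0
  pL' (suc i) = pL i
  bL' : ∀ i → back' (eL' i) ≡ inj₁ i
  bL' zero = refl
  bL' (suc i) = cong (Sum.map₁ suc) (bL i)
  eb' : ∀ x → [ eL' , (λ j → suc (eR j)) ]′ (back' x) ≡ x
  eb' zero = refl
  eb' (suc x) with back x | eb x
  ... | inj₁ i | q = cong suc q
  ... | inj₂ j | q = cong suc q
... | E | no np0 = record { a = a ; b = suc b ; eL = λ i → suc (eL i) ; eR = eR' ; back = back'
    ; pL = pL ; pR = pR' ; bL = λ i → cong (Sum.map₂ suc) (bL i) ; bR = bR' ; eb = eb' }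
  where
  open Partition E
  eR' : Fin (suc b) → Fin (suc n)
  eR' zero = zero
  eR' (suc i) = suc (eR i)
  back' : Fin (suc n) → Fin a ⊎ Fin (suc b)
  back' zero = inj₂ zero
  back' (suc x) = Sum.map₂ suc (back x)
  pR' : ∀ i → ¬ P (eR' i)
  pR' zero = np0
  pR' (suc i) = pR i
  bR' : ∀ i → back' (eR' i) ≡ inj₂ i
  bR' zero = refl
  bR' (suc i) = cong (Sum.map₂ suc) (bR i)
  eb' : ∀ x → [ (λ i → suc (eL i)) , eR' ]′ (back' x) ≡ x
  eb' zero = refl
  eb' (suc x) with back x | eb x
  ... | inj₁ i | q = cong suc q
  ... | inj₂ j | q = cong suc q

induced : ∀ {n a} → Graph n → (Fin a → Fin n) → Graph a
induced G e = record { adj = λ i j → adj G (e i) (e j) ; adj-sym = λ i j → adj-sym G (e i) (e j) ; adj-irr = λ i → adj-irr G (e i) }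

≅-join-parts : ∀ {n} (G : Graph n) {P : Fin n → Set} (E : Partition P) (cr : Bool) →
  (∀ i j → adj G (Partition.eL E i) (Partition.eR E j) ≡ cr) → G ≅ combine cr (induced G (Partition.eL E)) (induced G (Partition.eR E))
≅-join-parts G E cr hc = record { to = to' ; from = from' ; to-from = tf ; from-to = ft ; preserves = pres }
  where
  open Partition E
  to' : _ → Fin (a + b)
  to' x = [ (λ i → i ↑ˡ b) , (λ j → a ↑ʳ j) ]′ (back x)
  from' : Fin (a + b) → _
  from' y = [ eL , eR ]′ (splitAt a y)
  tf : ∀ y → to' (from' y) ≡ y
  tf y with split a b y
  ... | inl i rewrite splitAt-↑ˡ a i b | bL i = refl
  ... | inr j rewrite splitAt-↑ʳ a b j | bR j = refl
  ft : ∀ x → from' (to' x) ≡ x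
  ft x with back x | eb x
  ... | inj₁ i | q rewrite splitAt-↑ˡ a i b = q
  ... | inj₂ j | q rewrite splitAt-↑ʳ a b j = q
  pres : ∀ x y → adj (combine cr (induced G eL) (induced G eR)) (to' x) (to' y) ≡ adj G x y
  pres x y with back x | eb x | back y | eb y
  ... | inj₁ i | q | inj₁ j | r = trans (adj-ll cr (induced G eL) (induced G eR) i j) (cong₂ (adj G) q r)
  ... | inj₁ i | q | inj₂ j | r = trans (adj-lr cr (induced G eL) (induced G eR) i j) (trans (sym (hc i j)) (cong₂ (adj G) q r))
  ... | inj₂ i | q | inj₁ j | r = trans (adj-rl cr (induced G eL) (induced G eR) j i) (trans (sym (hc j i)) (trans (adj-sym G _ _) (cong₂ (adj G) q r)))
  ... | inj₂ i | q | inj₂ j | r = trans (adj-rr cr (induced G eL) (induced G eR) i j) (cong₂ (adj G) q r)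

firstTrue : ∀ {a} → (Fin a → Bool) → Maybe (Fin a)
firstTrue {zero} P = nothing
firstTrue {suc a} P with P zero
... | true = just zero
... | false = Maybe.map suc (firstTrue (λ t → P (suc t)))

firstTrue-ext : ∀ {a} (P Q : Fin a → Bool) → (∀ j → P j ≡ Q j) → firstTrue P ≡ firstTrue Q
firstTrue-ext {zero} P Q h = refl
firstTrue-ext {suc a} P Q h with P zero | Q zero | h zero
... | true | true | _ = refl
... | false | false | _ = cong (Maybe.map suc) (firstTrue-ext _ _ (λ j → h (suc j)))

firstTrue-sound : ∀ {a} (P : Fin a → Bool) r → firstTrue P ≡ just r → P r ≡ true
firstTrue-sound {suc a} P r e with P zero in pz
firstTrue-sound {suc a} P zero refl | true = pz
firstTrue-sound {suc a} P r e | false with firstTrue (λ t → P (suc t)) in ef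
firstTrue-sound {suc a} P (suc r) refl | false | just r' = firstTrue-sound (λ t → P (suc t)) r' ef

firstTrue-complete : ∀ {a} (P : Fin a → Bool) j → P j ≡ true → ∃ λ r → firstTrue P ≡ just r
firstTrue-complete {suc a} P j pj with P zero in pz
... | true = zero , refl
firstTrue-complete {suc a} P zero pj | false = ⊥-elim (true≢false (trans (sym pj) pz))
firstTrue-complete {suc a} P (suc j) pj | false with firstTrue-complete (λ t → P (suc t)) j pj
... | r , e = suc r , cong (Maybe.map suc) e

-- If non-adjacent vertices are twins, non-adjacency is an equivalence relation whose classes
-- are the parts; each vertex is sent to the first vertex of its class.
module TwinClasses {a : ℕ} (Y : Graph a) (ht : ∀ i j → i ≢ j → adj Y i j ≡ false → Twins Y i j) where
  N : Fin a → Fin a → Set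
  N i j = adj Y i j ≡ false

  Ntrans : ∀ {i j k} → N i j → N j k → N i k
  Ntrans {i} {j} {k} p q with i ≟ j
  ... | yes refl = q
  ... | no ne = trans (ht i j ne p k) q

  Nsym : ∀ {i j} → N i j → N j i
  Nsym {i} {j} p = trans (adj-sym Y j i) p

  P : Fin a → Fin a → Bool
  P i t = not (adj Y i t)

  notF : ∀ {b} → not b ≡ true → b ≡ false
  notF {false} _ = refl

  rep : Fin a → Fin a
  rep i = fromMaybe i (firstTrue (P i))

  repN : ∀ i → N i (rep i)
  repN i with firstTrue-complete (P i) i (cong not (adj-irr Y i))
  ... | r , e rewrite e = notF (firstTrue-sound (P i) r e)

  rep-eq : ∀ i j → N i j → rep i ≡ rep j
  rep-eq i j n with i ≟ j
  ... | yes refl = refl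
  ... | no ne with firstTrue-complete (P j) j (cong not (adj-irr Y j))
  ... | r , e = trans (cong (fromMaybe i) (trans (firstTrue-ext (P i) (P j) (λ t → cong not (ht i j ne n t))) e))
                      (cong (fromMaybe j) (sym e))

  rep-N : ∀ i j → rep i ≡ rep j → N i j
  rep-N i j e = Ntrans (repN i) (Nsym (subst (N j) (sym e) (repN j)))

  C = compress a rep
  open Compression C

  cm : IsCompleteMultipartite Y j
  cm = g , gsurj , λ i i' → (λ ad e → true≢false (trans (sym ad) (rep-N i i' (g⇒f i i' e)))) , nd i i'
    where
    nd : ∀ i i' → g i ≢ g i' → adj Y i i' ≡ true
    nd i i' ne with adj Y i i' in e
    ... | true = refl
    ... | false = ⊥-elim (ne (f⇒g i i' (rep-eq i i' e)))

  multipartite : CompleteMultipartite Y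
  multipartite = j , cm

  two-distinct⇒2≤ : ∀ {k} (x y : Fin k) → x ≢ y → 2 ≤ k
  two-distinct⇒2≤ {suc zero} zero zero ne = ⊥-elim (ne refl)
  two-distinct⇒2≤ {suc (suc k)} _ _ _ = s≤s (s≤s z≤n)

  multipartite≥2 : ∀ i i' → adj Y i i' ≡ true → CompleteMultipartite≥2 Y
  multipartite≥2 i i' ad = j , two-distinct⇒2≤ (g i) (g i') (proj₁ (proj₂ (proj₂ cm) i i') ad) , cm

FormA1 : ∀ {n} → Graph n → Set
FormA1 G = Σ ℕ λ a → Σ (Graph a) λ M → 1 ≤ a × CompleteMultipartite M ×
          ((G ≅ (M ∨ 2K₂)) ⊎
           (Σ ℕ λ c → Σ (Graph c) λ H → CompleteMultipartite≥2 H × (G ≅ (M ∨ (H ∪ K 1)))))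

FormA2 : ∀ {n} → Graph n → Set
FormA2 G = Σ ℕ λ c → Σ (Graph c) λ H → CompleteMultipartite≥2 H × (G ≅ (H ∪ K 1)) × ¬ (H ≅ K c)

FormB : ∀ {n} → Graph n → Set
FormB {n} G = (G ≅ 2K₂) ⊎ (G ≅ (K (n ∸ 1) ∪ K 1))

K-adj : ∀ {c} (i j : Fin c) → i ≢ j → adj (K c) i j ≡ true
K-adj i j ne with i ≟ j
... | yes e = ⊥-elim (ne e)
... | no _ = refl


record HK₁Shape {b : ℕ} (X : Graph b) : Set where
  field
    c : ℕ
    H : Graph c
    multipartite≥2 : CompleteMultipartite≥2 H
    iso : X ≅ (H ∪ K 1)

NonEdge : ∀ {c} → Graph c → Set
NonEdge {c} H = Σ (Fin c) λ x → Σ (Fin c) λ x' → x ≢ x' × adj H x x' ≡ false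

complete-or-nonEdge : ∀ {c} (H : Graph c) → (H ≅ K c) ⊎ NonEdge H
complete-or-nonEdge {c} H with all? (λ i → all? (λ j → ¬? (i ≟ j) →-dec (adj H i j ≟B true)))
... | yes h = inj₁ (record { to = λ i → i ; from = λ i → i ; to-from = λ _ → refl ; from-to = λ _ → refl ; preserves = pres })
  where
  pres : ∀ i j → adj (K c) i j ≡ adj H i j
  pres i j with i ≟ j
  ... | yes refl = sym (adj-irr H i)
  ... | no ne = sym (h i j ne)
... | no nh with ¬∀⟶∃¬ _ _ (λ i → all? (λ j → ¬? (i ≟ j) →-dec (adj H i j ≟B true))) nh
... | i , ni with ¬∀⟶∃¬ _ _ (λ j → ¬? (i ≟ j) →-dec (adj H i j ≟B true)) ni
... | j , nj with i ≟ j
...   | yes e = ⊥-elim (nj (λ ne → ⊥-elim (ne e)))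
...   | no ne = inj₂ (i , j , ne , adj-false H i j (λ a → nj (λ _ → a)))

nonEdge⇒¬complete : ∀ {c} {H : Graph c} → NonEdge H → ¬ (H ≅ K c)
nonEdge⇒¬complete (i , j , ne , a) φ =
  true≢false (trans (sym (K-adj _ _ (λ e → ne (to-injective φ e)))) (trans (preserves φ i j) a))

¬complete⇒nonEdge : ∀ {c} (H : Graph c) → ¬ (H ≅ K c) → NonEdge H
¬complete⇒nonEdge H nK = [ ⊥-elim ∘ nK , id ]′ (complete-or-nonEdge H)

module Decomposition {k : ℕ} (G : Graph (suc (suc k))) (hχ : IsχD G (suc k)) where
  open BadStructure G hχ

  E : Partition (λ x → ¬ BadVertex G x)
  E = partition (λ x → ¬? (badVertex? G x))
  open Partition E

  eR-bad : ∀ j → BadVertex G (eR j)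
  eR-bad j = decidable-stable (badVertex? G (eR j)) (pR j)

  ¬¬bad : ∀ x → BadVertex G x → ¬ ¬ BadVertex G x
  ¬¬bad x bx nbx = nbx bx

  M : Graph a
  M = induced G eL
  X : Graph b
  X = induced G eR

  G≅M∨X : G ≅ (M ∨ X)
  G≅M∨X = ≅-join-parts G E true (λ i j → good-adj-bad (eL i) (eR j) (pL i) (eR-bad j))

  M-multipartite : CompleteMultipartite M
  M-multipartite = TwinClasses.multipartite M (λ i j ne a → λ w → good-nonadj⇒twins (eL i) (eL j) (pL i) (λ e → ne (eL-inj e)) a (eL w))

  module Of2K₂ (o : BadIs2K₂ G) where
    open BadIs2K₂ o
    vert : Fin 4 → V
    vert 0F = u
    vert 1F = w
    vert 2F = v
    vert 3F = q
    uw' : u ≢ w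
    uw' = adj⇒≢ G uw
    uv' : u ≢ v
    uv' = adj-nonadj⇒≢ G (adj-true-sym G uw) wv
    uq' : u ≢ q
    uq' = ≢-sym (adj-nonadj⇒≢ G vq (adj-false-sym G uv))
    wv' : w ≢ v
    wv' = adj-nonadj⇒≢ G uw uv
    wq' : w ≢ q
    wq' = ≢-sym (adj-nonadj⇒≢ G vq (adj-false-sym G wv))
    vq' : v ≢ q
    vq' = adj⇒≢ G vq
    tab : ∀ c d → adj 2K₂ c d ≡ adj G (vert c) (vert d)
    tab 0F 0F = sym (adj-irr G u)
    tab 0F 1F = sym uw
    tab 0F 2F = sym uv
    tab 0F 3F = sym uq
    tab 1F 0F = sym (adj-true-sym G uw)
    tab 1F 1F = sym (adj-irr G w)
    tab 1F 2F = sym wv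
    tab 1F 3F = sym wq
    tab 2F 0F = sym (adj-false-sym G uv)
    tab 2F 1F = sym (adj-false-sym G wv)
    tab 2F 2F = sym (adj-irr G v)
    tab 2F 3F = sym vq
    tab 3F 0F = sym (adj-false-sym G uq)
    tab 3F 1F = sym (adj-false-sym G wq)
    tab 3F 2F = sym (adj-true-sym G vq)
    tab 3F 3F = sym (adj-irr G q)

    code : V → Fin 4
    code y with y ≟ u | y ≟ w | y ≟ v
    ... | yes _ | _ | _ = 0F
    ... | no _ | yes _ | _ = 1F
    ... | no _ | no _ | yes _ = 2F
    ... | no _ | no _ | no _ = 3F

    code-vert : ∀ c → code (vert c) ≡ c
    code-vert 0F with u ≟ u
    ... | yes _ = refl
    ... | no ne = ⊥-elim (ne refl)
    code-vert 1F with w ≟ u | w ≟ w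
    ... | yes e | _ = ⊥-elim (uw' (sym e))
    ... | no _ | yes _ = refl
    ... | no _ | no ne = ⊥-elim (ne refl)
    code-vert 2F with v ≟ u | v ≟ w | v ≟ v
    ... | yes e | _ | _ = ⊥-elim (uv' (sym e))
    ... | no _ | yes e | _ = ⊥-elim (wv' (sym e))
    ... | no _ | no _ | yes _ = refl
    ... | no _ | no _ | no ne = ⊥-elim (ne refl)
    code-vert 3F with q ≟ u | q ≟ w | q ≟ v
    ... | yes e | _ | _ = ⊥-elim (uq' (sym e))
    ... | no _ | yes e | _ = ⊥-elim (wq' (sym e))
    ... | no _ | no _ | yes e = ⊥-elim (vq' (sym e))
    ... | no _ | no _ | no _ = refl

    vert-code : ∀ y → BadVertex G y → vert (code y) ≡ y
    vert-code y by with onlyB y by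
    ... | inj₁ refl = cong vert (code-vert 0F)
    ... | inj₂ (inj₁ refl) = cong vert (code-vert 1F)
    ... | inj₂ (inj₂ (inj₁ refl)) = cong vert (code-vert 2F)
    ... | inj₂ (inj₂ (inj₂ refl)) = cong vert (code-vert 3F)

    Bvert : ∀ c → BadVertex G (vert c)
    Bvert 0F = Bu
    Bvert 1F = Bw
    Bvert 2F = Bv
    Bvert 3F = Bq

    idx : Fin 4 → Fin b
    idx c = proj₁ (findR (vert c) (¬¬bad _ (Bvert c)))
    idx-spec : ∀ c → eR (idx c) ≡ vert c
    idx-spec c = proj₂ (findR (vert c) (¬¬bad _ (Bvert c)))

    vc : ∀ j → vert (code (eR j)) ≡ eR j
    vc j = vert-code (eR j) (eR-bad j)

    X≅2K₂ : X ≅ 2K₂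
    X≅2K₂ = record { to = λ j → code (eR j) ; from = idx
      ; to-from = λ c → trans (cong code (idx-spec c)) (code-vert c)
      ; from-to = λ j → eR-inj (trans (idx-spec (code (eR j))) (vc j))
      ; preserves = λ i j → trans (tab (code (eR i)) (code (eR j))) (cong₂ (adj G) (vc i) (vc j)) }

  module OfHK₁ (o : BadIsHK₁ G) where
    open BadIsHK₁ o
    E' : Partition (λ j → eR j ≢ z)
    E' = partition (λ j → ¬? (eR j ≟ z))
    module E' = Partition E'

    H : Graph E'.a
    H = induced X E'.eL
    Y : Graph E'.b
    Y = induced X E'.eR

    zof : ∀ j → eR (E'.eR j) ≡ z
    zof j = decidable-stable (eR (E'.eR j) ≟ z) (E'.pR j)

    nzof : ∀ i → eR (E'.eL i) ≢ z
    nzof = E'.pL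

    isoXHY : X ≅ (H ∪ Y)
    isoXHY = ≅-join-parts X E' false (λ i j → trans (cong (adj G (eR (E'.eL i))) (zof j)) (adj-false-sym G (Iz _ (eR-bad _))))

    jz0 = proj₁ (findR z (¬¬bad z Bz))
    jz = proj₁ (E'.findR jz0 (λ ne → ne (proj₂ (findR z (¬¬bad z Bz)))))

    isoY : Y ≅ K 1
    isoY = record { to = λ _ → zero ; from = λ _ → jz ; to-from = tf ; from-to = ft ; preserves = pr }
      where
      tf : ∀ (y : Fin 1) → zero ≡ y
      tf zero = refl
      ft : ∀ j → jz ≡ j
      ft j = E'.eR-inj (eR-inj (trans (zof jz) (sym (zof j))))
      pr : ∀ i j → adj (K 1) zero zero ≡ adj Y i j
      pr i j = sym (trans (cong₂ (adj G) (zof i) (zof j)) (adj-irr G z))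

    twH : ∀ i j → i ≢ j → adj H i j ≡ false → Twins H i j
    twH i j ne a w = twB (eR (E'.eL i)) (eR (E'.eL j)) (eR-bad _) (eR-bad _) (nzof i) (nzof j)
                       (λ e → ne (E'.eL-inj (eR-inj e))) a (eR (E'.eL w))

    ix : ∀ y → BadVertex G y → y ≢ z → Σ (Fin E'.a) λ i → eR (E'.eL i) ≡ y
    ix y by yz = proj₁ found-i , trans (cong eR (proj₂ found-i)) (proj₂ found-j)
      where
      found-j = findR y (¬¬bad y by)
      found-i = E'.findL (proj₁ found-j) (λ e → yz (trans (sym (proj₂ found-j)) e))

    shape : HK₁Shape X
    shape = record { c = E'.a ; H = H
      ; multipartite≥2 = TwinClasses.multipartite≥2 H twH i1 i2 (trans (cong₂ (adj G) (proj₂ (ix e1 Be1 e1z)) (proj₂ (ix e2 Be2 e2z))) e12)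
      ; iso = ≅-trans isoXHY (combine-cong false (≅-refl H) isoY) }
      where
      i1 = proj₁ (ix e1 Be1 e1z)
      i2 = proj₁ (ix e2 Be2 e2z)

  ∨-empty : ∀ {b'} (M0 : Graph 0) (X0 : Graph b') → (M0 ∨ X0) ≅ X0
  ∨-empty M0 X0 = record { to = λ x → x ; from = λ x → x ; to-from = λ _ → refl ; from-to = λ _ → refl ; preserves = λ _ _ → refl }

  assemble : ∀ a' (M' : Graph a') b' (X' : Graph b') → CompleteMultipartite M' → G ≅ (M' ∨ X')
         → (X' ≅ 2K₂) ⊎ HK₁Shape X' → FormA1 G ⊎ FormA2 G ⊎ FormB G
  assemble zero M' b' X' cm φ (inj₁ ψ) = inj₂ (inj₂ (inj₁ (≅-trans φ (≅-trans (∨-empty M' X') ψ))))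
  assemble (suc a') M' b' X' cm φ (inj₁ ψ) = inj₁ (suc a' , M' , s≤s z≤n , cm , inj₁ (≅-trans φ (combine-cong true (≅-refl M') ψ)))
  assemble (suc a') M' b' X' cm φ (inj₂ h) = inj₁ (suc a' , M' , s≤s z≤n , cm , inj₂ (HK₁Shape.c h , HK₁Shape.H h , HK₁Shape.multipartite≥2 h , ≅-trans φ (combine-cong true (≅-refl M') (HK₁Shape.iso h))))
  assemble zero M' b' X' cm φ (inj₂ h) with complete-or-nonEdge (HK₁Shape.H h)
  ... | inj₂ ne = inj₂ (inj₁ (HK₁Shape.c h , HK₁Shape.H h , HK₁Shape.multipartite≥2 h , φ' , nonEdge⇒¬complete ne))
    where
    φ' : G ≅ (HK₁Shape.H h ∪ K 1)
    φ' = ≅-trans φ (≅-trans (∨-empty M' X') (HK₁Shape.iso h))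
  ... | inj₁ hk = inj₂ (inj₂ (inj₂ (subst (λ m → G ≅ (K m ∪ K 1)) (sym ceq) φ'')))
    where
    φ' : G ≅ (HK₁Shape.H h ∪ K 1)
    φ' = ≅-trans φ (≅-trans (∨-empty M' X') (HK₁Shape.iso h))
    φ'' : G ≅ (K (HK₁Shape.c h) ∪ K 1)
    φ'' = ≅-trans φ' (combine-cong false hk (≅-refl (K 1)))
    ceq : suc k ≡ HK₁Shape.c h
    ceq = ℕ.suc-injective (trans (≅-order φ') (ℕ.+-comm (HK₁Shape.c h) 1))

  forms : FormA1 G ⊎ FormA2 G ⊎ FormB G
  forms with classify
  ... | inj₁ o = assemble a M b X M-multipartite G≅M∨X (inj₁ (Of2K₂.X≅2K₂ o))
  ... | inj₂ o = assemble a M b X M-multipartite G≅M∨X (inj₂ (OfHK₁.shape o))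

-- Distinguishing colourings of a doubled graph

Rigid : ∀ {N k} → Graph N → (Fin N → Fin k) → Set
Rigid {N} F c = (f : Fin N → Fin N) → (∀ x → c (f x) ≡ c x) → (∀ x y → adj F (f x) (f y) ≡ adj F x y) → ∀ x → f x ≡ x

NoCross : ∀ {N k} → Graph N → (Fin N → Set) → (Fin N → Fin k) → (Fin N → Fin k) → Set
NoCross {N} F R ca cb = (f : Fin N → Fin N) → (∀ r → R r → cb (f r) ≡ ca r) → (∀ r → R r → R (f r))
   → (∀ r r' → R r → R r' → adj F (f r) (f r') ≡ adj F r r') → (∀ r r' → R r → R r' → f r ≡ f r' → r ≡ r') → ⊥

Isolated : ∀ {N} → Graph N → Fin N → Set
Isolated F x = ∀ t → adj F x t ≡ false

-- A colour-preserving automorphism cannot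
-- move the vertices of R, all within distance two of the hub w, to the other copy (NoCross), nor an
-- isolated vertex (hz); so it restricts to each copy, where it is the identity by rigidity.
module DoubleColouring {N k : ℕ} (F : Graph N) (c1 c2 : Fin N → Fin k) (R : Fin N → Set) (w : Fin N)
  (hub : ∀ r → R r → r ≡ w ⊎ adj F w r ≡ true ⊎ ∃ λ s → adj F w s ≡ true × adj F s r ≡ true)
  (hR : ∀ x → R x ⊎ Isolated F x)
  (hnb : ∀ r → R r → ∃ λ s → adj F r s ≡ true)
  (nc12 : NoCross F R c1 c2) (nc21 : NoCross F R c2 c1)
  (hz : ∀ x y → Isolated F x → Isolated F y → c1 x ≢ c2 y)
  (rig1 : Rigid F c1) (rig2 : Rigid F c2)
  (pr1 : Proper F c1) (pr2 : Proper F c2)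
  (surjc : ∀ α → (∃ λ x → c1 x ≡ α) ⊎ (∃ λ x → c2 x ≡ α)) where

  FF = F ∪ F
  W = Fin (N + N)

  sideL : W → Bool
  sideL x = [ (λ _ → true) , (λ _ → false) ]′ (splitAt N x)
  lidx : W → Fin N
  lidx x = [ (λ i → i) , (λ j → j) ]′ (splitAt N x)
  cc : Bool → Fin N → Fin k
  cc true = c1
  cc false = c2
  col : W → Fin k
  col x = cc (sideL x) (lidx x)

  sL : ∀ i → sideL (i ↑ˡ N) ≡ true
  sL i rewrite splitAt-↑ˡ N i N = refl
  sR : ∀ j → sideL (N ↑ʳ j) ≡ false
  sR j rewrite splitAt-↑ʳ N N j = refl
  lL : ∀ i → lidx (i ↑ˡ N) ≡ i
  lL i rewrite splitAt-↑ˡ N i N = refl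
  lR : ∀ j → lidx (N ↑ʳ j) ≡ j
  lR j rewrite splitAt-↑ʳ N N j = refl
  colL : ∀ i → col (i ↑ˡ N) ≡ c1 i
  colL i rewrite splitAt-↑ˡ N i N = refl
  colR : ∀ j → col (N ↑ʳ j) ≡ c2 j
  colR j rewrite splitAt-↑ʳ N N j = refl

  eqL : ∀ x → sideL x ≡ true → x ≡ lidx x ↑ˡ N
  eqL x e with split N N x
  ... | inl i = cong (_↑ˡ N) (sym (lL i))
  ... | inr j = ⊥-elim (true≢false (trans (sym e) (sR j)))
  eqR : ∀ x → sideL x ≡ false → x ≡ N ↑ʳ lidx x
  eqR x e with split N N x
  ... | inl i = ⊥-elim (true≢false (trans (sym (sL i)) e))
  ... | inr j = cong (N ↑ʳ_) (sym (lR j))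

  adjSide : ∀ x y → adj FF x y ≡ true → sideL x ≡ sideL y
  adjSide x y a with split N N x | split N N y
  ... | inl i | inl j = trans (sL i) (sym (sL j))
  ... | inl i | inr j = ⊥-elim (true≢false (trans (sym a) (adj-lr false F F i j)))
  ... | inr i | inl j = ⊥-elim (true≢false (trans (sym a) (adj-rl false F F j i)))
  ... | inr i | inr j = trans (sR i) (sym (sR j))

  adjSame : ∀ x y → sideL x ≡ sideL y → adj FF x y ≡ adj F (lidx x) (lidx y)
  adjSame x y e with split N N x | split N N y
  ... | inl i | inl j = trans (adj-ll false F F i j) (sym (cong₂ (adj F) (lL i) (lL j)))
  ... | inl i | inr j = ⊥-elim (true≢false (trans (sym (sL i)) (trans e (sR j))))
  ... | inr i | inl j = ⊥-elim (true≢false (trans (sym (sL j)) (trans (sym e) (sR i))))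
  ... | inr i | inr j = trans (adj-rr false F F i j) (sym (cong₂ (adj F) (lR i) (lR j)))

  if' : Bool → Fin N → W
  if' true y = y ↑ˡ N
  if' false y = N ↑ʳ y

  module Automorphism (σ : Aut FF) (h : ∀ x → col (to σ x) ≡ col x) where
    s = to σ
    ps : ∀ x y → adj FF (s x) (s y) ≡ adj FF x y
    ps = preserves σ
    sideS : ∀ x y → adj FF x y ≡ true → sideL (s x) ≡ sideL (s y)
    sideS x y a = adjSide (s x) (s y) (trans (ps x y) a)
    nbR : ∀ x t → adj F x t ≡ true → R x
    nbR x t a with hR x
    ... | inj₁ r = r
    ... | inj₂ iso = ⊥-elim (true≢false (trans (sym a) (iso t)))
    hubSide : ∀ (emb : Fin N → W) → (∀ i j → adj FF (emb i) (emb j) ≡ adj F i j) → ∀ r → R r → sideL (s (emb r)) ≡ sideL (s (emb w))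
    hubSide emb ea r rr with hub r rr
    ... | inj₁ refl = refl
    ... | inj₂ (inj₁ a) = sym (sideS (emb w) (emb r) (trans (ea w r) a))
    ... | inj₂ (inj₂ (t , a1 , a2)) = trans (sym (sideS (emb t) (emb r) (trans (ea t r) a2))) (sym (sideS (emb w) (emb t) (trans (ea w t) a1)))
    cross : ∀ (emb : Fin N → W) (ca cb : Fin N → Fin k) (b : Bool)
            → (∀ i j → adj FF (emb i) (emb j) ≡ adj F i j) → (∀ i → col (emb i) ≡ ca i)
            → (∀ y → col (if' b y) ≡ cb y) → (∀ y → sideL (if' b y) ≡ b) → (∀ y → lidx (if' b y) ≡ y)
            → NoCross F R ca cb → (∀ r → R r → sideL (s (emb r)) ≡ b) → (∀ {i j} → emb i ≡ emb j → i ≡ j) → ⊥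
    cross emb ca cb b ea ce cbe sb lb ncr allb einj = ncr f fc fR fadj finj
      where
      f : Fin N → Fin N
      f r = lidx (s (emb r))
      fe : ∀ r → R r → s (emb r) ≡ if' b (f r)
      fe r rr = back b (allb r rr)
        where
        back : ∀ b' → sideL (s (emb r)) ≡ b' → s (emb r) ≡ if' b' (f r)
        back true e = eqL _ e
        back false e = eqR _ e
      fc : ∀ r → R r → cb (f r) ≡ ca r
      fc r rr = trans (sym (cbe (f r))) (trans (cong col (sym (fe r rr))) (trans (h (emb r)) (ce r)))
      fadj : ∀ r r' → R r → R r' → adj F (f r) (f r') ≡ adj F r r'
      fadj r r' rr rr' = trans (sym (cong₂ (adj F) (lb (f r)) (lb (f r'))))
                          (trans (sym (adjSame (if' b (f r)) (if' b (f r')) (trans (sb _) (sym (sb _)))))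
                           (trans (cong₂ (adj FF) (sym (fe r rr)) (sym (fe r' rr'))) (trans (ps (emb r) (emb r')) (ea r r'))))
      fR : ∀ r → R r → R (f r)
      fR r rr with hnb r rr
      ... | t , a = nbR (f r) (f t) (trans (fadj r t rr (nbR t r (trans (adj-sym F t r) a))) a)
      finj : ∀ r r' → R r → R r' → f r ≡ f r' → r ≡ r'
      finj r r' rr rr' e = einj (to-injective σ (trans (fe r rr) (trans (cong (if' b) e) (sym (fe r' rr')))))

    embL embR : Fin N → W
    embL i = i ↑ˡ N
    embR j = N ↑ʳ j
    eaL : ∀ i j → adj FF (embL i) (embL j) ≡ adj F i j
    eaL = adj-ll false F F
    eaR : ∀ i j → adj FF (embR i) (embR j) ≡ adj F i j
    eaR = adj-rr false F F

    hubL : sideL (s (embL w)) ≡ true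
    hubL with sideL (s (embL w)) in e
    ... | true = refl
    ... | false = ⊥-elim (cross embL c1 c2 false eaL colL colR sR lR nc12 (λ r rr → trans (hubSide embL eaL r rr) e) (↑ˡ-inj N))
    hubR : sideL (s (embR w)) ≡ false
    hubR with sideL (s (embR w)) in e
    ... | false = refl
    ... | true = ⊥-elim (cross embR c2 c1 true eaR colR colL sL lL nc21 (λ r rr → trans (hubSide embR eaR r rr) e) (↑ʳ-inj N))

    isoImg : ∀ x → Isolated F (lidx x) → Isolated F (lidx (s x))
    isoImg x ix t with adj F (lidx (s x)) t in a
    ... | false = refl
    ... | true = ⊥-elim (true≢false (trans (sym a3) a2))
      where
      y' = s x
      t' = if' (sideL y') t
      sideT : ∀ b' y → sideL (if' b' y) ≡ b'
      sideT true y = sL y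
      sideT false y = sR y
      lidT : ∀ b' y → lidx (if' b' y) ≡ y
      lidT true y = lL y
      lidT false y = lR y
      a1 : adj FF y' t' ≡ true
      a1 = trans (adjSame y' t' (sym (sideT (sideL y') t))) (trans (cong (adj F (lidx y')) (lidT (sideL y') t)) a)
      a3 : adj FF x (from σ t') ≡ true
      a3 = trans (sym (cong (λ z → adj FF z (from σ t')) (from-to σ x))) (trans (from-preserves σ (s x) t') a1)
      a2 : adj FF x (from σ t') ≡ false
      a2 = trans (adjSame x (from σ t') (adjSide x (from σ t') a3)) (ix _)

    allL : ∀ i → sideL (s (embL i)) ≡ true
    allL i with hR i
    ... | inj₁ ri = trans (hubSide embL eaL i ri) hubL
    ... | inj₂ ii with sideL (s (embL i)) in e
    ...   | true = refl
    ...   | false = ⊥-elim (hz i y ii iy (sym cy))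
      where
      y = lidx (s (embL i))
      iy : Isolated F y
      iy = isoImg (embL i) (subst (Isolated F) (sym (lL i)) ii)
      cy : c2 y ≡ c1 i
      cy = trans (sym (colR y)) (trans (cong col (sym (eqR _ e))) (trans (h (embL i)) (colL i)))
    allR : ∀ i → sideL (s (embR i)) ≡ false
    allR i with hR i
    ... | inj₁ ri = trans (hubSide embR eaR i ri) hubR
    ... | inj₂ ii with sideL (s (embR i)) in e
    ...   | false = refl
    ...   | true = ⊥-elim (hz y i iy ii cy)
      where
      y = lidx (s (embR i))
      iy : Isolated F y
      iy = isoImg (embR i) (subst (Isolated F) (sym (lR i)) ii)
      cy : c1 y ≡ c2 i
      cy = trans (sym (colL y)) (trans (cong col (sym (eqL _ e))) (trans (h (embR i)) (colR i)))

    f1 f2 : Fin N → Fin N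
    f1 i = lidx (s (embL i))
    f2 i = lidx (s (embR i))
    e1 : ∀ i → s (embL i) ≡ embL (f1 i)
    e1 i = eqL _ (allL i)
    e2 : ∀ i → s (embR i) ≡ embR (f2 i)
    e2 i = eqR _ (allR i)
    fix1 : ∀ i → f1 i ≡ i
    fix1 = rig1 f1 (λ i → trans (sym (colL (f1 i))) (trans (cong col (sym (e1 i))) (trans (h (embL i)) (colL i))))
                   (λ i j → trans (sym (eaL (f1 i) (f1 j))) (trans (sym (cong₂ (adj FF) (e1 i) (e1 j))) (trans (ps _ _) (eaL i j))))
    fix2 : ∀ i → f2 i ≡ i
    fix2 = rig2 f2 (λ i → trans (sym (colR (f2 i))) (trans (cong col (sym (e2 i))) (trans (h (embR i)) (colR i))))
                   (λ i j → trans (sym (eaR (f2 i) (f2 j))) (trans (sym (cong₂ (adj FF) (e2 i) (e2 j))) (trans (ps _ _) (eaR i j))))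
    fixes-all : ∀ x → s x ≡ x
    fixes-all x with split N N x
    ... | inl i = trans (e1 i) (cong embL (fix1 i))
    ... | inr j = trans (e2 j) (cong embR (fix2 j))

  dist : DistColoring FF k
  dist = record { col = col ; surj = surj' ; proper = proper' ; distinguishing = Automorphism.fixes-all }
    where
    surj' : ∀ α → ∃ λ x → col x ≡ α
    surj' α with surjc α
    ... | inj₁ (x , e) = x ↑ˡ N , trans (colL x) e
    ... | inj₂ (x , e) = N ↑ʳ x , trans (colR x) e
    proper' : ∀ x y → adj FF x y ≡ true → col x ≢ col y
    proper' x y a with split N N x | split N N y
    ... | inl i | inl j = λ e → pr1 i j (trans (sym (adj-ll false F F i j)) a) (trans (sym (colL i)) (trans e (colL j)))
    ... | inl i | inr j = ⊥-elim (true≢false (trans (sym a) (adj-lr false F F i j)))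
    ... | inr i | inl j = ⊥-elim (true≢false (trans (sym a) (adj-rl false F F j i)))
    ... | inr i | inr j = λ e → pr2 i j (trans (sym (adj-rr false F F i j)) a) (trans (sym (colR i)) (trans e (colR j)))



rigid-by-pair : ∀ {N k} (F : Graph N) (c : Fin N → Fin k) (p q : Fin N) → p ≢ q
  → (∀ x y → c x ≡ c y → x ≡ y ⊎ (OneOf p q x × OneOf p q y))
  → (t : Fin N) → t ≢ p → t ≢ q → adj F p t ≢ adj F q t → Rigid F c
rigid-by-pair F c p q pq ker t tp tq nt f fc fadj x with ker (f x) x (fc x)
... | inj₁ e = e
... | inj₂ (hf , hx) with f x ≟ x
...   | yes e = e
...   | no ne = ⊥-elim (go hf hx ne)
  where
  ft : f t ≡ t
  ft with ker (f t) t (fc t)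
  ... | inj₁ e = e
  ... | inj₂ (_ , inj₁ e) = ⊥-elim (tp e)
  ... | inj₂ (_ , inj₂ e) = ⊥-elim (tq e)
  at : adj F (f x) t ≡ adj F x t
  at = trans (cong (adj F (f x)) (sym ft)) (fadj x t)
  go : OneOf p q (f x) → OneOf p q x → f x ≢ x → ⊥
  go (inj₁ a) (inj₁ b) ne = ne (trans a (sym b))
  go (inj₂ a) (inj₂ b) ne = ne (trans a (sym b))
  go (inj₁ a) (inj₂ b) ne = nt (trans (cong (λ z → adj F z t) (sym a)) (trans at (cong (λ z → adj F z t) b)))
  go (inj₂ a) (inj₁ b) ne = nt (sym (trans (cong (λ z → adj F z t) (sym a)) (trans at (cong (λ z → adj F z t) b))))

noCross-by-count : ∀ {N k} (F : Graph N) (R : Fin N → Set) (ca cb : Fin N → Fin k) (α : Fin k) (r r' : Fin N)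
  → R r → R r' → r ≢ r' → ca r ≡ α → ca r' ≡ α → (∀ s s' → R s → R s' → cb s ≡ α → cb s' ≡ α → s ≡ s')
  → NoCross F R ca cb
noCross-by-count F R ca cb α r r' Rr Rr' ne e1 e2 uniq f fc fR fadj finj =
  ne (finj r r' Rr Rr' (uniq (f r) (f r') (fR r Rr) (fR r' Rr') (trans (fc r Rr) e1) (trans (fc r' Rr') e2)))

noCross-by-miss : ∀ {N k} (F : Graph N) (R : Fin N → Set) (ca cb : Fin N → Fin k) (r : Fin N)
  → R r → (∀ s → R s → cb s ≢ ca r) → NoCross F R ca cb
noCross-by-miss F R ca cb r Rr miss f fc fR fadj finj = miss (f r) (fR r Rr) (fc r Rr)

proper-by-kernel : ∀ {N k} (F : Graph N) (c : Fin N → Fin k) (p q : Fin N)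
  → (∀ x y → c x ≡ c y → x ≡ y ⊎ (OneOf p q x × OneOf p q y)) → adj F p q ≡ false → Proper F c
proper-by-kernel F c p q ker apq x y a e with ker x y e
... | inj₁ refl = true≢false (trans (sym a) (adj-irr F x))
... | inj₂ (inj₁ refl , inj₁ refl) = true≢false (trans (sym a) (adj-irr F x))
... | inj₂ (inj₁ refl , inj₂ refl) = true≢false (trans (sym a) apq)
... | inj₂ (inj₂ refl , inj₁ refl) = true≢false (trans (sym a) (trans (adj-sym F q p) apq))
... | inj₂ (inj₂ refl , inj₂ refl) = true≢false (trans (sym a) (adj-irr F x))

cases : ∀ {a b} {A : Set} → (Fin a → A) → (Fin b → A) → Fin (a + b) → A
cases {a} f g x = [ f , g ]′ (splitAt a x)

casesL : ∀ {a b} {A : Set} (f : Fin a → A) (g : Fin b → A) i → cases f g (i ↑ˡ b) ≡ f i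
casesL {a} {b} f g i rewrite splitAt-↑ˡ a i b = refl

casesR : ∀ {a b} {A : Set} (f : Fin a → A) (g : Fin b → A) j → cases {a} f g (a ↑ʳ j) ≡ g j
casesR {a} {b} f g j rewrite splitAt-↑ʳ a b j = refl

-- Upper bounds

-- Both colourings give each vertex of M its own colour and the edges 0–1, 2–3 of 2K₂ three further
-- colours, with 0 and 2 sharing one; they differ in which colour is shared.
module Join2K₂ {a' : ℕ} (M : Graph (suc a')) where
  a = suc a'
  Fg = M ∨ 2K₂
  N = a + 4
  k = a + 3
  mv : Fin a → Fin N
  mv i = i ↑ˡ 4
  kv : Fin 4 → Fin N
  kv j = a ↑ʳ j
  mcol : Fin a → Fin k
  mcol i = i ↑ˡ 3
  kcol : Fin 3 → Fin k
  kcol t = a ↑ʳ t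

  t1 t2 : Fin 4 → Fin 3
  t1 0F = 0F
  t1 1F = 1F
  t1 2F = 0F
  t1 3F = 2F
  t2 0F = 1F
  t2 1F = 0F
  t2 2F = 1F
  t2 3F = 2F

  c1 c2 : Fin N → Fin k
  c1 = cases mcol (λ j → kcol (t1 j))
  c2 = cases mcol (λ j → kcol (t2 j))

  P02 : Fin 4 → Set
  P02 = OneOf 0F 2F

  tk1 : ∀ j j' → t1 j ≡ t1 j' → j ≡ j' ⊎ (P02 j × P02 j')
  tk1 0F 0F e = inj₁ refl
  tk1 0F 2F e = inj₂ (inj₁ refl , inj₂ refl)
  tk1 2F 0F e = inj₂ (inj₂ refl , inj₁ refl)
  tk1 1F 1F e = inj₁ refl
  tk1 2F 2F e = inj₁ refl
  tk1 3F 3F e = inj₁ refl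
  tk1 0F 1F ()
  tk1 0F 3F ()
  tk1 1F 0F ()
  tk1 1F 2F ()
  tk1 1F 3F ()
  tk1 2F 1F ()
  tk1 2F 3F ()
  tk1 3F 0F ()
  tk1 3F 1F ()
  tk1 3F 2F ()

  tk2 : ∀ j j' → t2 j ≡ t2 j' → j ≡ j' ⊎ (P02 j × P02 j')
  tk2 0F 0F e = inj₁ refl
  tk2 0F 2F e = inj₂ (inj₁ refl , inj₂ refl)
  tk2 2F 0F e = inj₂ (inj₂ refl , inj₁ refl)
  tk2 1F 1F e = inj₁ refl
  tk2 2F 2F e = inj₁ refl
  tk2 3F 3F e = inj₁ refl
  tk2 0F 1F ()
  tk2 0F 3F ()
  tk2 1F 0F ()
  tk2 1F 2F ()
  tk2 1F 3F ()
  tk2 2F 1F ()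
  tk2 2F 3F ()
  tk2 3F 0F ()
  tk2 3F 1F ()
  tk2 3F 2F ()

  ker : (t : Fin 4 → Fin 3) → (∀ j j' → t j ≡ t j' → j ≡ j' ⊎ (P02 j × P02 j'))
      → ∀ x y → cases mcol (λ j → kcol (t j)) x ≡ cases mcol (λ j → kcol (t j)) y
      → x ≡ y ⊎ (OneOf (kv 0F) (kv 2F) x × OneOf (kv 0F) (kv 2F) y)
  ker t tk x y e with split a 4 x | split a 4 y
  ... | inl i | inl j = inj₁ (cong mv (↑ˡ-inj 3 (trans (sym (casesL mcol _ i)) (trans e (casesL mcol _ j)))))
  ... | inl i | inr j = ⊥-elim (↑ˡ≢↑ʳ i (t j) (trans (sym (casesL mcol _ i)) (trans e (casesR {a} mcol _ j))))
  ... | inr i | inl j = ⊥-elim (↑ˡ≢↑ʳ j (t i) (sym (trans (sym (casesR {a} mcol _ i)) (trans e (casesL mcol _ j)))))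
  ... | inr i | inr j with tk i j (↑ʳ-inj a (trans (sym (casesR {a} mcol _ i)) (trans e (casesR {a} mcol _ j))))
  ... | inj₁ refl = inj₁ refl
  ... | inj₂ (pi , pj) = inj₂ (lift pi , lift pj)
    where
    lift : ∀ {j} → P02 j → OneOf (kv 0F) (kv 2F) (kv j)
    lift (inj₁ refl) = inj₁ refl
    lift (inj₂ refl) = inj₂ refl

  aMK : ∀ i j → adj Fg (mv i) (kv j) ≡ true
  aMK = adj-lr true M 2K₂
  aKM : ∀ i j → adj Fg (kv j) (mv i) ≡ true
  aKM = adj-rl true M 2K₂
  aKK : ∀ i j → adj Fg (kv i) (kv j) ≡ adj 2K₂ i j
  aKK = adj-rr true M 2K₂

  R : Fin N → Set
  R _ = ⊤

  nb : ∀ x → ∃ λ s → adj Fg x s ≡ true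
  nb x with split a 4 x
  ... | inl i = kv 0F , aMK i 0F
  ... | inr j = mv 0F , aKM 0F j

  noIsol : ∀ x → Isolated Fg x → ⊥
  noIsol x ix with nb x
  ... | s , e = true≢false (trans (sym e) (ix s))

  hub : ∀ r → R r → r ≡ kv 0F ⊎ adj Fg (kv 0F) r ≡ true ⊎ ∃ λ s → adj Fg (kv 0F) s ≡ true × adj Fg s r ≡ true
  hub r _ with split a 4 r
  ... | inl i = inj₂ (inj₁ (aKM i 0F))
  ... | inr j = inj₂ (inj₂ (mv 0F , aKM 0F 0F , aMK 0F j))

  c1-kv : ∀ j → c1 (kv j) ≡ kcol (t1 j)
  c1-kv j = casesR {a} mcol _ j
  c2-kv : ∀ j → c2 (kv j) ≡ kcol (t2 j)
  c2-kv j = casesR {a} mcol _ j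

  uniq : (t : Fin 4 → Fin 3) (β : Fin 3) → (∀ j → t j ≡ β → j ≡ 1F)
       → ∀ s s' → R s → R s' → cases mcol (λ j → kcol (t j)) s ≡ kcol β → cases mcol (λ j → kcol (t j)) s' ≡ kcol β → s ≡ s'
  uniq t β h s s' _ _ e e' = trans (one s e) (sym (one s' e'))
    where
    one : ∀ s → cases mcol (λ j → kcol (t j)) s ≡ kcol β → s ≡ kv 1F
    one s e with split a 4 s
    ... | inl i = ⊥-elim (↑ˡ≢↑ʳ i β (trans (sym (casesL mcol _ i)) e))
    ... | inr j = cong kv (h j (↑ʳ-inj a (trans (sym (casesR {a} mcol _ j)) e)))

  h1 : ∀ j → t1 j ≡ 1F → j ≡ 1F
  h1 1F _ = refl
  h1 0F ()
  h1 2F ()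
  h1 3F ()
  h2 : ∀ j → t2 j ≡ 0F → j ≡ 1F
  h2 1F _ = refl
  h2 0F ()
  h2 2F ()
  h2 3F ()

  kv-inj : ∀ {i j} → kv i ≡ kv j → i ≡ j
  kv-inj = ↑ʳ-inj a

  k02 : kv 0F ≢ kv 2F
  k02 e with kv-inj e
  ... | ()
  k10 : kv 1F ≢ kv 0F
  k10 e with kv-inj e
  ... | ()
  k12 : kv 1F ≢ kv 2F
  k12 e with kv-inj e
  ... | ()

  wit : adj Fg (kv 0F) (kv 1F) ≢ adj Fg (kv 2F) (kv 1F)
  wit e = true≢false (trans (sym (aKK 0F 1F)) (trans e (aKK 2F 1F)))

  a02 : adj Fg (kv 0F) (kv 2F) ≡ false
  a02 = aKK 0F 2F

  surj1 : ∀ α → ∃ λ x → c1 x ≡ α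
  surj1 α with split a 3 α
  ... | inl i = mv i , casesL mcol _ i
  ... | inr 0F = kv 0F , c1-kv 0F
  ... | inr 1F = kv 1F , c1-kv 1F
  ... | inr 2F = kv 3F , c1-kv 3F

  dist : DistColoring (Fg ∪ Fg) k
  dist = DoubleColouring.dist Fg c1 c2 R (kv 0F) hub (λ _ → inj₁ tt) (λ r _ → nb r)
    (noCross-by-count Fg R c1 c2 (kcol 0F) (kv 0F) (kv 2F) tt tt k02 (c1-kv 0F) (c1-kv 2F) (uniq t2 0F h2))
    (noCross-by-count Fg R c2 c1 (kcol 1F) (kv 0F) (kv 2F) tt tt k02 (c2-kv 0F) (c2-kv 2F) (uniq t1 1F h1))
    (λ x y ix _ _ → noIsol x ix)
    (rigid-by-pair Fg c1 (kv 0F) (kv 2F) k02 (ker t1 tk1) (kv 1F) k10 k12 wit)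
    (rigid-by-pair Fg c2 (kv 0F) (kv 2F) k02 (ker t2 tk2) (kv 1F) k10 k12 wit)
    (proper-by-kernel Fg c1 _ _ (ker t1 tk1) a02) (proper-by-kernel Fg c2 _ _ (ker t2 tk2) a02)
    (λ α → inj₁ (surj1 α))

-- The isolated vertex borrows the colour of h0 in one copy and that of h1 in the other.
module JoinHK₁ {a' c : ℕ} (M : Graph (suc a')) (H : Graph c) (h0 h1 : Fin c) (a01 : adj H h0 h1 ≡ true) where
  a = suc a'
  HK = H ∪ K 1
  Fg = M ∨ HK
  N = a + (c + 1)
  k = a + c
  mv : Fin a → Fin N
  mv i = i ↑ˡ (c + 1)
  hv : Fin c → Fin N
  hv h = a ↑ʳ (h ↑ˡ 1)
  zv : Fin N
  zv = a ↑ʳ (c ↑ʳ 0F)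

  data View : Fin N → Set where
    vM : ∀ i → View (mv i)
    vH : ∀ h → View (hv h)
    vZ : View zv

  view : ∀ x → View x
  view x with split a (c + 1) x
  ... | inl i = vM i
  ... | inr j with split c 1 j
  ... | inl h = vH h
  ... | inr 0F = vZ

  mcol : Fin a → Fin k
  mcol i = i ↑ˡ c
  hcol : Fin c → Fin k
  hcol h = a ↑ʳ h

  col : Fin c → Fin N → Fin k
  col g = cases mcol (cases hcol (λ _ → hcol g))

  colM : ∀ g i → col g (mv i) ≡ mcol i
  colM g i = casesL mcol _ i
  colH : ∀ g h → col g (hv h) ≡ hcol h
  colH g h = trans (casesR {a} mcol _ (h ↑ˡ 1)) (casesL hcol _ h)
  colZ : ∀ g → col g zv ≡ hcol g
  colZ g = trans (casesR {a} mcol _ (c ↑ʳ 0F)) (casesR {c} hcol _ 0F)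

  aMX : ∀ i j → adj Fg (mv i) (a ↑ʳ j) ≡ true
  aMX = adj-lr true M HK
  aXM : ∀ i j → adj Fg (a ↑ʳ j) (mv i) ≡ true
  aXM = adj-rl true M HK
  aXX : ∀ i j → adj Fg (a ↑ʳ i) (a ↑ʳ j) ≡ adj HK i j
  aXX = adj-rr true M HK
  aHH : ∀ h h' → adj Fg (hv h) (hv h') ≡ adj H h h'
  aHH h h' = trans (aXX _ _) (adj-ll false H (K 1) h h')
  aHZ : ∀ h → adj Fg (hv h) zv ≡ false
  aHZ h = trans (aXX _ _) (adj-lr false H (K 1) h 0F)
  aZH : ∀ h → adj Fg zv (hv h) ≡ false
  aZH h = trans (aXX _ _) (adj-rl false H (K 1) h 0F)

  hv-inj : ∀ {h h'} → hv h ≡ hv h' → h ≡ h'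
  hv-inj e = ↑ˡ-inj 1 (↑ʳ-inj a e)
  hv≢zv : ∀ h → hv h ≢ zv
  hv≢zv h e = ↑ˡ≢↑ʳ h 0F (↑ʳ-inj a e)

  h01 : h0 ≢ h1
  h01 e = true≢false (trans (sym a01) (trans (cong (λ t → adj H t h1) e) (adj-irr H h1)))

  ker : ∀ g x y → col g x ≡ col g y → x ≡ y ⊎ (OneOf (hv g) zv x × OneOf (hv g) zv y)
  ker g x y e with view x | view y
  ... | vM i | vM j = inj₁ (cong mv (↑ˡ-inj c (trans (sym (colM g i)) (trans e (colM g j)))))
  ... | vM i | vH h = ⊥-elim (↑ˡ≢↑ʳ i h (trans (sym (colM g i)) (trans e (colH g h))))
  ... | vM i | vZ = ⊥-elim (↑ˡ≢↑ʳ i g (trans (sym (colM g i)) (trans e (colZ g))))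
  ... | vH h | vM i = ⊥-elim (↑ˡ≢↑ʳ i h (sym (trans (sym (colH g h)) (trans e (colM g i)))))
  ... | vZ | vM i = ⊥-elim (↑ˡ≢↑ʳ i g (sym (trans (sym (colZ g)) (trans e (colM g i)))))
  ... | vH h | vH h' = inj₁ (cong hv (↑ʳ-inj a (trans (sym (colH g h)) (trans e (colH g h')))))
  ... | vH h | vZ = inj₂ (inj₁ (cong hv (↑ʳ-inj a (trans (sym (colH g h)) (trans e (colZ g))))) , inj₂ refl)
  ... | vZ | vH h = inj₂ (inj₂ refl , inj₁ (cong hv (↑ʳ-inj a (sym (trans (sym (colZ g)) (trans e (colH g h)))))))
  ... | vZ | vZ = inj₁ refl

  R : Fin N → Set
  R _ = ⊤

  nb : ∀ x → ∃ λ s → adj Fg x s ≡ true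
  nb x with view x
  ... | vM i = zv , aMX i _
  ... | vH h = mv 0F , aXM 0F _
  ... | vZ = mv 0F , aXM 0F _

  hub : ∀ r → R r → r ≡ zv ⊎ adj Fg zv r ≡ true ⊎ ∃ λ s → adj Fg zv s ≡ true × adj Fg s r ≡ true
  hub r _ with view r
  ... | vM i = inj₂ (inj₁ (aXM i _))
  ... | vH h = inj₂ (inj₂ (mv 0F , aXM 0F _ , aMX 0F _))
  ... | vZ = inj₁ refl

  uniq : ∀ g g' → g' ≢ g → ∀ s s' → R s → R s' → col g' s ≡ hcol g → col g' s' ≡ hcol g → s ≡ s'
  uniq g g' ne s s' _ _ e e' = trans (one s e) (sym (one s' e'))
    where
    one : ∀ s → col g' s ≡ hcol g → s ≡ hv g
    one s e with view s
    ... | vM i = ⊥-elim (↑ˡ≢↑ʳ i g (trans (sym (colM g' i)) e))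
    ... | vH h = cong hv (↑ʳ-inj a (trans (sym (colH g' h)) e))
    ... | vZ = ⊥-elim (ne (↑ʳ-inj a (trans (sym (colZ g')) e)))

  rig : ∀ g g' → adj H g g' ≡ true → Rigid Fg (col g)
  rig g g' agg = rigid-by-pair Fg (col g) (hv g) zv (hv≢zv g) (ker g) (hv g') (λ e → gg' (sym (hv-inj e))) (hv≢zv g')
        (λ e → true≢false (trans (sym (trans (aHH g g') agg)) (trans e (aZH g'))))
    where
    gg' : g ≢ g'
    gg' e = true≢false (trans (sym agg) (trans (cong (λ t → adj H t g') e) (adj-irr H g')))

  surj : ∀ g α → ∃ λ x → col g x ≡ α
  surj g α with split a c α
  ... | inl i = mv i , colM g i
  ... | inr h = hv h , colH g h

  a10 : adj H h1 h0 ≡ true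
  a10 = trans (adj-sym H h1 h0) a01

  dist : DistColoring (Fg ∪ Fg) k
  dist = DoubleColouring.dist Fg (col h0) (col h1) R zv hub (λ _ → inj₁ tt) (λ r _ → nb r)
    (noCross-by-count Fg R (col h0) (col h1) (hcol h0) (hv h0) zv tt tt (hv≢zv h0) (colH h0 h0) (colZ h0) (uniq h0 h1 (λ e → h01 (sym e))))
    (noCross-by-count Fg R (col h1) (col h0) (hcol h1) (hv h1) zv tt tt (hv≢zv h1) (colH h1 h1) (colZ h1) (uniq h1 h0 h01))
    (λ x y ix _ _ → noIsol x ix)
    (rig h0 h1 a01) (rig h1 h0 a10)
    (proper-by-kernel Fg (col h0) _ _ (ker h0) (aHZ h0)) (proper-by-kernel Fg (col h1) _ _ (ker h1) (aHZ h1))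
    (λ α → inj₁ (surj h0 α))
    where
    noIsol : ∀ x → Isolated Fg x → ⊥
    noIsol x ix with nb x
    ... | s , e = true≢false (trans (sym e) (ix s))

module HK₁ {c : ℕ} (H : Graph c) where
  Fg = H ∪ K 1
  N = c + 1
  hv : Fin c → Fin N
  hv h = h ↑ˡ 1
  zv : Fin N
  zv = c ↑ʳ 0F

  data View : Fin N → Set where
    vH : ∀ h → View (hv h)
    vZ : View zv

  view : ∀ x → View x
  view x with split c 1 x
  ... | inl h = vH h
  ... | inr 0F = vZ

  aHH : ∀ h h' → adj Fg (hv h) (hv h') ≡ adj H h h'
  aHH = adj-ll false H (K 1)
  aHZ : ∀ h → adj Fg (hv h) zv ≡ false
  aHZ h = adj-lr false H (K 1) h 0F
  aZH : ∀ h → adj Fg zv (hv h) ≡ false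
  aZH h = adj-rl false H (K 1) h 0F
  aZZ : adj Fg zv zv ≡ false
  aZZ = adj-irr Fg zv

  hv-inj : ∀ {h h'} → hv h ≡ hv h' → h ≡ h'
  hv-inj = ↑ˡ-inj 1
  hv≢zv : ∀ h → hv h ≢ zv
  hv≢zv h = ↑ˡ≢↑ʳ h 0F

  R : Fin N → Set
  R v = Σ (Fin c) λ h → hv h ≡ v

  isoZ : Isolated Fg zv
  isoZ t with view t
  ... | vH h = aZH h
  ... | vZ = aZZ

  hR : ∀ v → R v ⊎ Isolated Fg v
  hR v with view v
  ... | vH h = inj₁ (h , refl)
  ... | vZ = inj₂ isoZ

  colr : ∀ {k} → (Fin c → Fin k) → Fin k → Fin N → Fin k
  colr f z = cases f (λ _ → z)
  colH : ∀ {k} (f : Fin c → Fin k) z h → colr f z (hv h) ≡ f h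
  colH f z h = casesL f _ h
  colZ : ∀ {k} (f : Fin c → Fin k) z → colr f z zv ≡ z
  colZ f z = casesR {c} f _ 0F

  ker : ∀ {k} (f : Fin c → Fin k) g → (∀ h h' → f h ≡ f h' → h ≡ h') →
        ∀ x y → colr f (f g) x ≡ colr f (f g) y → x ≡ y ⊎ (OneOf (hv g) zv x × OneOf (hv g) zv y)
  ker f g finj x y e with view x | view y
  ... | vH h | vH h' = inj₁ (cong hv (finj h h' (trans (sym (colH f _ h)) (trans e (colH f _ h')))))
  ... | vH h | vZ = inj₂ (inj₁ (cong hv (finj h g (trans (sym (colH f _ h)) (trans e (colZ f _))))) , inj₂ refl)
  ... | vZ | vH h = inj₂ (inj₂ refl , inj₁ (cong hv (finj h g (sym (trans (sym (colZ f _)) (trans e (colH f _ h)))))))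
  ... | vZ | vZ = inj₁ refl

  isolH : ∀ h → (∃ λ g → adj H h g ≡ true) → ¬ Isolated Fg (hv h)
  isolH h (g , e) ih = true≢false (trans (sym e) (trans (sym (aHH h g)) (ih (hv g))))

  onlyZ : (∀ h → ∃ λ g → adj H h g ≡ true) → ∀ v → Isolated Fg v → v ≡ zv
  onlyZ nbH v iv with view v
  ... | vH h = ⊥-elim (isolH h (nbH h) iv)
  ... | vZ = refl

  rig : ∀ {k} (f : Fin c → Fin k) g t → (∀ h h' → f h ≡ f h' → h ≡ h') → adj H g t ≡ true → Rigid Fg (colr f (f g))
  rig f g t finj agt = rigid-by-pair Fg (colr f (f g)) (hv g) zv (hv≢zv g) (ker f g finj) (hv t) (λ e → gt (sym (hv-inj e))) (hv≢zv t)
      (λ e → true≢false (trans (sym (trans (aHH g t) agt)) (trans e (aZH t))))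
    where
    gt : g ≢ t
    gt e = true≢false (trans (sym agt) (trans (cong (λ z → adj H z t) e) (adj-irr H t)))

  proper : ∀ {k} (f : Fin c → Fin k) g → (∀ h h' → f h ≡ f h' → h ≡ h') → Proper Fg (colr f (f g))
  proper f g finj = proper-by-kernel Fg _ _ _ (ker f g finj) (aHZ g)

  lift : ∀ h → R (hv h)
  lift h = h , refl

-- Here x x' is a non-edge of H and y lies in another part. The isolated vertex borrows the colour
-- of x in one copy, and of x' in the other, where the colours of x and y are exchanged.
module HK₁-noncomplete {c : ℕ} (H : Graph c) (x x' y : Fin c) (xx' : x ≢ x') (axx' : adj H x x' ≡ false)
            (axy : adj H x y ≡ true) (ax'y : adj H x' y ≡ true)
            (nbH : ∀ h → ∃ λ g → adj H h g ≡ true)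
            (hubH : ∀ h → h ≡ x ⊎ adj H x h ≡ true ⊎ ∃ λ s → adj H x s ≡ true × adj H s h ≡ true) where
  open HK₁ H

  xy : x ≢ y
  xy e = true≢false (trans (sym axy) (trans (cong (λ z → adj H z y) e) (adj-irr H y)))
  x'y : x' ≢ y
  x'y e = true≢false (trans (sym ax'y) (trans (cong (λ z → adj H z y) e) (adj-irr H y)))

  f1 f2 : Fin c → Fin c
  f1 h = h
  f2 = swap x y
  f1inj : ∀ h h' → f1 h ≡ f1 h' → h ≡ h'
  f1inj h h' e = e
  f2inj : ∀ h h' → f2 h ≡ f2 h' → h ≡ h'
  f2inj h h' e = trans (sym (swap-involutive x y h)) (trans (cong (swap x y) e) (swap-involutive x y h'))

  x'fix : swap x y x' ≡ x'
  x'fix = swap-other x y x' (λ e → xx' (sym e)) x'y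

  c1 c2 : Fin (c + 1) → Fin c
  c1 = colr f1 (f1 x)
  c2 = colr f2 (f2 x')

  hub : ∀ r → R r → r ≡ hv x ⊎ adj Fg (hv x) r ≡ true ⊎ ∃ λ s → adj Fg (hv x) s ≡ true × adj Fg s r ≡ true
  hub r (h , refl) with hubH h
  ... | inj₁ e = inj₁ (cong hv e)
  ... | inj₂ (inj₁ a) = inj₂ (inj₁ (trans (aHH x h) a))
  ... | inj₂ (inj₂ (s , a1 , a2)) = inj₂ (inj₂ (hv s , trans (aHH x s) a1 , trans (aHH s h) a2))

  hnb : ∀ r → R r → ∃ λ s → adj Fg r s ≡ true
  hnb r (h , refl) with nbH h
  ... | g , e = hv g , trans (aHH h g) e

  -- A colour-matching map would send the non-edge x x' to the edge y x'.
  ncGen : (ca cb : Fin (c + 1) → Fin c) → (∀ g → cb (hv g) ≡ ca (hv x) → g ≡ y) → (∀ g → cb (hv g) ≡ ca (hv x') → g ≡ x')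
        → NoCross Fg R ca cb
  ncGen ca cb gy gx' f fc fR fadj finj with fR (hv x) (lift x) | fR (hv x') (lift x')
  ... | (g , eg) | (g' , eg') = true≢false (trans (sym (trans (aHH y x') (trans (adj-sym H y x') ax'y))) (trans (cong₂ (adj Fg) (cong hv (sym e1)) (cong hv (sym e2))) (trans (cong₂ (adj Fg) eg eg') (trans (fadj (hv x) (hv x') (lift x) (lift x')) (trans (aHH x x') axx')))))
    where
    e1 : g ≡ y
    e1 = gy g (trans (cong cb eg) (fc (hv x) (lift x)))
    e2 : g' ≡ x'
    e2 = gx' g' (trans (cong cb eg') (fc (hv x') (lift x')))

  gy12 : ∀ g → c2 (hv g) ≡ c1 (hv x) → g ≡ y
  gy12 g e = trans (sym (swap-involutive x y g)) (trans (cong (swap x y) (trans (sym (colH f2 _ g)) (trans e (colH f1 _ x)))) (swap-u x y))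
  gx12 : ∀ g → c2 (hv g) ≡ c1 (hv x') → g ≡ x'
  gx12 g e = trans (sym (swap-involutive x y g)) (trans (cong (swap x y) (trans (sym (colH f2 _ g)) (trans e (colH f1 _ x')))) x'fix)
  gy21 : ∀ g → c1 (hv g) ≡ c2 (hv x) → g ≡ y
  gy21 g e = trans (sym (colH f1 _ g)) (trans e (trans (colH f2 _ x) (swap-u x y)))
  gx21 : ∀ g → c1 (hv g) ≡ c2 (hv x') → g ≡ x'
  gx21 g e = trans (sym (colH f1 _ g)) (trans e (trans (colH f2 _ x') x'fix))

  hz : ∀ u v → Isolated Fg u → Isolated Fg v → c1 u ≢ c2 v
  hz u v iu iv e = xx' (trans (sym (colZ f1 _)) (trans (cong c1 (sym (onlyZ nbH u iu))) (trans e (trans (cong c2 (onlyZ nbH v iv)) (trans (colZ f2 _) x'fix)))))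

  dist : DistColoring (Fg ∪ Fg) c
  dist = DoubleColouring.dist Fg c1 c2 R (hv x) hub hR hnb (ncGen c1 c2 gy12 gx12) (ncGen c2 c1 gy21 gx21) hz
    (rig f1 x y f1inj axy) (rig f2 x' y f2inj ax'y) (proper f1 x f1inj) (proper f2 x' f2inj)
    (λ α → inj₁ (hv α , colH f1 _ α))

-- The two copies of K_c avoid colour 0 and colour 1 respectively.
module KK₁-upper (c'' : ℕ) where
  c : ℕ
  c = suc (suc c'')
  open HK₁ (K c)


  f1 f2 : Fin c → Fin (suc c)
  f1 h = suc h
  f2 0F = 0F
  f2 (suc h) = suc (suc h)
  f1inj : ∀ h h' → f1 h ≡ f1 h' → h ≡ h'
  f1inj h h' refl = refl
  f2inj : ∀ h h' → f2 h ≡ f2 h' → h ≡ h'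
  f2inj 0F 0F _ = refl
  f2inj (suc h) (suc h') refl = refl
  f2inj 0F (suc h') ()
  f2inj (suc h) 0F ()

  c1 c2 : Fin (c + 1) → Fin (suc c)
  c1 = colr f1 (f1 0F)
  c2 = colr f2 (f2 0F)

  hub : ∀ r → R r → r ≡ hv 0F ⊎ adj Fg (hv 0F) r ≡ true ⊎ ∃ λ s → adj Fg (hv 0F) s ≡ true × adj Fg s r ≡ true
  hub r (0F , refl) = inj₁ refl
  hub r (suc h , refl) = inj₂ (inj₁ (trans (aHH 0F (suc h)) (K-adj 0F (suc h) (λ ()))))

  nbK : ∀ h → ∃ λ g → adj (K c) h g ≡ true
  nbK 0F = 1F , refl
  nbK (suc h) = 0F , K-adj (suc h) 0F (λ ())

  hnb : ∀ r → R r → ∃ λ s → adj Fg r s ≡ true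
  hnb r (h , refl) with nbK h
  ... | g , e = hv g , trans (aHH h g) e

  nc12 : NoCross Fg R c1 c2
  nc12 = noCross-by-miss Fg R c1 c2 (hv 0F) (lift 0F) miss
    where
    miss : ∀ s → R s → c2 s ≢ c1 (hv 0F)
    miss s (g , refl) e = m g (trans (sym (colH f2 (f2 0F) g)) (trans e (colH f1 (f1 0F) 0F)))
      where
      m : ∀ g → f2 g ≢ 1F
      m 0F ()
      m (suc g) ()
  nc21 : NoCross Fg R c2 c1
  nc21 = noCross-by-miss Fg R c2 c1 (hv 0F) (lift 0F) miss
    where
    miss : ∀ s → R s → c1 s ≢ c2 (hv 0F)
    miss s (g , refl) e with trans (sym (colH f1 (f1 0F) g)) (trans e (colH f2 (f2 0F) 0F))
    ... | ()

  hz : ∀ u v → Isolated Fg u → Isolated Fg v → c1 u ≢ c2 v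
  hz u v iu iv e with trans (sym (colZ f1 (f1 0F))) (trans (cong c1 (sym (onlyZ nbK u iu))) (trans e (trans (cong c2 (onlyZ nbK v iv)) (colZ f2 (f2 0F)))))
  ... | ()

  surj : ∀ α → (∃ λ x → c1 x ≡ α) ⊎ (∃ λ x → c2 x ≡ α)
  surj 0F = inj₂ (hv 0F , colH f2 (f2 0F) 0F)
  surj (suc β) = inj₁ (hv β , colH f1 (f1 0F) β)

  dist : DistColoring (Fg ∪ Fg) (suc c)
  dist = DoubleColouring.dist Fg c1 c2 R (hv 0F) hub hR hnb nc12 nc21 hz
    (rig f1 0F 1F f1inj refl) (rig f2 0F 1F f2inj refl) (proper f1 0F f1inj) (proper f2 0F f2inj) surj

-- The exceptional graphs 2K₂ and K_c ∪ K₁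

4K₂ : Graph 8
4K₂ = 2K₂ ∪ 2K₂

-- The four edges get the distinct colour pairs {3, 0}, {1, 0}, {2, 0}, {1, 2}.
col-4K₂ : Fin 8 → Fin 4
col-4K₂ 0F = 3F
col-4K₂ 1F = 0F
col-4K₂ 2F = 1F
col-4K₂ 3F = 0F
col-4K₂ 4F = 2F
col-4K₂ 5F = 0F
col-4K₂ 6F = 1F
col-4K₂ 7F = 2F

A = adj 4K₂

fx0 : ∀ y → col-4K₂ y ≡ 3F → y ≡ 0F
fx0 = toWitness {a? = all? (λ y → (col-4K₂ y ≟ 3F) →-dec (y ≟ 0F))} _
fx1 : ∀ y → A (0F) y ≡ true → y ≡ 1F
fx1 = toWitness {a? = all? (λ y → (A (0F) y ≟B true) →-dec (y ≟ 1F))} _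
fx2 : ∀ y z → col-4K₂ y ≡ 1F → A y z ≡ true → col-4K₂ z ≡ 0F → y ≡ 2F
fx2 = toWitness {a? = all? (λ y → all? (λ z → (col-4K₂ y ≟ 1F) →-dec ((A y z ≟B true) →-dec ((col-4K₂ z ≟ 0F) →-dec (y ≟ 2F)))))} _
fx3 : ∀ y → A (2F) y ≡ true → y ≡ 3F
fx3 = toWitness {a? = all? (λ y → (A (2F) y ≟B true) →-dec (y ≟ 3F))} _
fx4 : ∀ y z → col-4K₂ y ≡ 2F → A y z ≡ true → col-4K₂ z ≡ 0F → y ≡ 4F
fx4 = toWitness {a? = all? (λ y → all? (λ z → (col-4K₂ y ≟ 2F) →-dec ((A y z ≟B true) →-dec ((col-4K₂ z ≟ 0F) →-dec (y ≟ 4F)))))} _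
fx5 : ∀ y → A (4F) y ≡ true → y ≡ 5F
fx5 = toWitness {a? = all? (λ y → (A (4F) y ≟B true) →-dec (y ≟ 5F))} _
fx6 : ∀ y z → col-4K₂ y ≡ 1F → A y z ≡ true → col-4K₂ z ≡ 2F → y ≡ 6F
fx6 = toWitness {a? = all? (λ y → all? (λ z → (col-4K₂ y ≟ 1F) →-dec ((A y z ≟B true) →-dec ((col-4K₂ z ≟ 2F) →-dec (y ≟ 6F)))))} _
fx7 : ∀ y → A (6F) y ≡ true → y ≡ 7F
fx7 = toWitness {a? = all? (λ y → (A (6F) y ≟B true) →-dec (y ≟ 7F))} _

proper-4K₂ : ∀ i j → A i j ≡ true → col-4K₂ i ≢ col-4K₂ j
proper-4K₂ = toWitness {a? = all? (λ i → all? (λ j → (A i j ≟B true) →-dec ¬? (col-4K₂ i ≟ col-4K₂ j)))} _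

surj-4K₂ : ∀ c → ∃ λ i → col-4K₂ i ≡ c
surj-4K₂ 0F = 1F , refl
surj-4K₂ 1F = 2F , refl
surj-4K₂ 2F = 4F , refl
surj-4K₂ 3F = 0F , refl

dist-4K₂ : DistColoring 4K₂ 4
dist-4K₂ = record { col = col-4K₂ ; surj = surj-4K₂ ; proper = proper-4K₂ ; distinguishing = dis }
  where
  dis : (σ : Aut 4K₂) → (∀ i → col-4K₂ (to σ i) ≡ col-4K₂ i) → ∀ i → to σ i ≡ i
  dis σ h = all8
    where
    s = to σ
    ps : ∀ x y → A (s x) (s y) ≡ A x y
    ps = preserves σ
    e0 : s (0F) ≡ 0F
    e0 = fx0 _ (h _)
    e1 : s (1F) ≡ 1F
    e1 = fx1 _ (trans (cong (λ t → A t (s (1F))) (sym e0)) (ps _ _))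
    e2 : s (2F) ≡ 2F
    e2 = fx2 _ (s (3F)) (h _) (ps _ _) (h _)
    e3 : s (3F) ≡ 3F
    e3 = fx3 _ (trans (cong (λ t → A t (s (3F))) (sym e2)) (ps _ _))
    e4 : s (4F) ≡ 4F
    e4 = fx4 _ (s (5F)) (h _) (ps _ _) (h _)
    e5 : s (5F) ≡ 5F
    e5 = fx5 _ (trans (cong (λ t → A t (s (5F))) (sym e4)) (ps _ _))
    e6 : s (6F) ≡ 6F
    e6 = fx6 _ (s (7F)) (h _) (ps _ _) (h _)
    e7 : s (7F) ≡ 7F
    e7 = fx7 _ (trans (cong (λ t → A t (s (7F))) (sym e6)) (ps _ _))
    all8 : ∀ i → s i ≡ i
    all8 0F = e0
    all8 1F = e1
    all8 2F = e2
    all8 3F = e3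
    all8 4F = e4
    all8 5F = e5
    all8 6F = e6
    all8 7F = e7

vertex : Fin 4 → Fin 2 → Fin 8
vertex 0F 0F = 0F
vertex 0F 1F = 1F
vertex 1F 0F = 2F
vertex 1F 1F = 3F
vertex 2F 0F = 4F
vertex 2F 1F = 5F
vertex 3F 0F = 6F
vertex 3F 1F = 7F

edgeOf : Fin 8 → Fin 4
edgeOf 0F = 0F
edgeOf 1F = 0F
edgeOf 2F = 1F
edgeOf 3F = 1F
edgeOf 4F = 2F
edgeOf 5F = 2F
edgeOf 6F = 3F
edgeOf 7F = 3F

endOf : Fin 8 → Fin 2
endOf 0F = 0F
endOf 1F = 1F
endOf 2F = 0F
endOf 3F = 1F
endOf 4F = 0F
endOf 5F = 1F
endOf 6F = 0F
endOf 7F = 1F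

flip : Bool → Fin 2 → Fin 2
flip false t = t
flip true 0F = 1F
flip true 1F = 0F

perm : Fin 4 → Fin 4 → Bool → Fin 8 → Fin 8
perm i j b x with edgeOf x ≟ i | edgeOf x ≟ j
... | yes _ | _ = vertex j (flip b (endOf x))
... | no _ | yes _ = vertex i (flip b (endOf x))
... | no _ | no _ = x

allB : ∀ {P : Bool → Set} → Dec (P false) → Dec (P true) → Dec (∀ b → P b)
allB (yes p) (yes q) = yes λ { false → p ; true → q }
allB (no np) _ = no λ h → np (h false)
allB (yes _) (no nq) = no λ h → nq (h true)

perm-preserves : ∀ i j b → i ≢ j → ∀ x y → A (perm i j b x) (perm i j b y) ≡ A x y
perm-preserves = toWitness {a? = all? λ i → all? λ j → allB (D i j false) (D i j true)} _
  where
  D : ∀ i j b → Dec (i ≢ j → ∀ x y → A (perm i j b x) (perm i j b y) ≡ A x y)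
  D i j b = ¬? (i ≟ j) →-dec all? λ x → all? λ y → A (perm i j b x) (perm i j b y) ≟B A x y

perm-involutive : ∀ i j b → i ≢ j → ∀ x → perm i j b (perm i j b x) ≡ x
perm-involutive = toWitness {a? = all? λ i → all? λ j → allB (D i j false) (D i j true)} _
  where
  D : ∀ i j b → Dec (i ≢ j → ∀ x → perm i j b (perm i j b x) ≡ x)
  D i j b = ¬? (i ≟ j) →-dec all? λ x → perm i j b (perm i j b x) ≟ x

PermView : Fin 4 → Fin 4 → Bool → Fin 8 → Set
PermView i j b x = (perm i j b x ≡ x) ⊎ (Σ (Fin 2) λ t → x ≡ vertex i t × perm i j b x ≡ vertex j (flip b t)) ⊎ (Σ (Fin 2) λ t → x ≡ vertex j (flip b t) × perm i j b x ≡ vertex i t)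

perm-view : ∀ i j b → i ≢ j → ∀ x → PermView i j b x
perm-view = toWitness {a? = all? λ i → all? λ j → allB (D i j false) (D i j true)} _
  where
  D : ∀ i j b → Dec (i ≢ j → ∀ x → PermView i j b x)
  D i j b = ¬? (i ≟ j) →-dec all? λ x → (perm i j b x ≟ x) ⊎-dec (any? λ t → (x ≟ vertex i t) ×-dec (perm i j b x ≟ vertex j (flip b t))) ⊎-dec (any? λ t → (x ≟ vertex j (flip b t)) ×-dec (perm i j b x ≟ vertex i t))

perm-moves : ∀ i j b → i ≢ j → perm i j b (vertex i 0F) ≢ vertex i 0F
perm-moves = toWitness {a? = all? λ i → all? λ j → allB (D i j false) (D i j true)} _
  where
  D : ∀ i j b → Dec (i ≢ j → perm i j b (vertex i 0F) ≢ vertex i 0F)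
  D i j b = ¬? (i ≟ j) →-dec ¬? (perm i j b (vertex i 0F) ≟ vertex i 0F)

edgeA : ∀ e → A (vertex e 0F) (vertex e 1F) ≡ true
edgeA 0F = refl
edgeA 1F = refl
edgeA 2F = refl
edgeA 3F = refl

-- The colour missing from a pair of distinct colours: it determines the unordered pair.
missing : Fin 3 → Fin 3 → Fin 3
missing 0F 0F = 0F
missing 0F 1F = 2F
missing 0F 2F = 1F
missing 1F 0F = 2F
missing 1F 1F = 0F
missing 1F 2F = 0F
missing 2F 0F = 1F
missing 2F 1F = 0F
missing 2F 2F = 0F

missing-injective : ∀ a b a' b' → a ≢ b → a' ≢ b' → missing a b ≡ missing a' b' → (a ≡ a' × b ≡ b') ⊎ (a ≡ b' × b ≡ a')
missing-injective = toWitness {a? = all? λ a → all? λ b → all? λ a' → all? λ b' → ¬? (a ≟ b) →-dec (¬? (a' ≟ b') →-dec ((missing a b ≟ missing a' b') →-dec (((a ≟ a') ×-dec (b ≟ b')) ⊎-dec ((a ≟ b') ×-dec (b ≟ a')))))} _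

-- Two of the four edges carry the same pair of colours, and exchanging them preserves colours.
no-dist-4K₂-3 : DistColoring 4K₂ 3 → ⊥
no-dist-4K₂-3 D with pigeonhole (s≤s (s≤s (s≤s (s≤s z≤n)))) f
  where
  open DistColoring D
  f : Fin 4 → Fin 3
  f e = missing (col (vertex e 0F)) (col (vertex e 1F))
... | i , j , i<j , e = go (missing-injective _ _ _ _ (pe i) (pe j) e)
  where
  open DistColoring D
  pe : ∀ e → col (vertex e 0F) ≢ col (vertex e 1F)
  pe e = proper _ _ (edgeA e)
  ij : i ≢ j
  ij refl = ℕ.<-irrefl refl i<j
  fin : ∀ b → (∀ t → col (vertex i t) ≡ col (vertex j (flip b t))) → ⊥
  fin b cond = perm-moves i j b ij (distinguishing σ cp (vertex i 0F))
    where
    σ : Aut 4K₂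
    σ = involution⇒Aut 4K₂ (perm i j b) (perm-involutive i j b ij) (perm-preserves i j b ij)
    cp : ∀ x → col (perm i j b x) ≡ col x
    cp x = by-view (perm-view i j b ij x)
      where
      by-view : PermView i j b x → col (perm i j b x) ≡ col x
      by-view (inj₁ q) = cong col q
      by-view (inj₂ (inj₁ (t , q1 , q2))) = trans (cong col q2) (trans (sym (cond t)) (cong col (sym q1)))
      by-view (inj₂ (inj₂ (t , q1 , q2))) = trans (cong col q2) (trans (cond t) (cong col (sym q1)))
  go : (col (vertex i 0F) ≡ col (vertex j 0F) × col (vertex i 1F) ≡ col (vertex j 1F))
     ⊎ (col (vertex i 0F) ≡ col (vertex j 1F) × col (vertex i 1F) ≡ col (vertex j 0F)) → ⊥
  go (inj₁ (a , b)) = fin false λ { 0F → a ; 1F → b }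
  go (inj₂ (a , b)) = fin true λ { 0F → a ; 1F → b }

injective⇒surjective : ∀ {m} (f : Fin m → Fin m) → (∀ {x y} → f x ≡ f y → x ≡ y) → ∀ y → ∃ λ x → f x ≡ y
injective⇒surjective {suc m} f finj y with any? (λ x → f x ≟ y)
... | yes r = r
... | no nr = ⊥-elim (ℕ.1+n≰n (injective⇒≤ {f = f'} f'inj))
  where
  ne : ∀ x → y ≢ f x
  ne x e = nr (x , sym e)
  f' : Fin (suc m) → Fin m
  f' x = punchOut (ne x)
  f'inj : ∀ {x x'} → f' x ≡ f' x' → x ≡ x'
  f'inj e = finj (punchOut-injective (ne _) (ne _) e)

K-preserves : ∀ {c} (f : Fin c → Fin c) → (∀ {x y} → f x ≡ f y → x ≡ y) → ∀ i j → adj (K c) (f i) (f j) ≡ adj (K c) i j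
K-preserves f finj i j with f i ≟ f j | i ≟ j
... | yes _ | yes _ = refl
... | no _ | no _ = refl
... | yes e | no ne = ⊥-elim (ne (finj e))
... | no ne | yes refl = ⊥-elim (ne refl)

module KK₁-lower (c' : ℕ) where
  c : ℕ
  c = suc c'
  FK = K c ∪ K 1
  G2 = FK ∪ FK
  N = c + 1
  q1 q2 : Fin c → Fin (N + N)
  q1 h = (h ↑ˡ 1) ↑ˡ N
  q2 h = N ↑ʳ (h ↑ˡ 1)
  z1 z2 : Fin (N + N)
  z1 = (c ↑ʳ zero) ↑ˡ N
  z2 = N ↑ʳ (c ↑ʳ zero)

  data View : Fin (N + N) → Set where
    v1 : ∀ h → View (q1 h)
    v2 : ∀ h → View (q2 h)
    w1 : View z1
    w2 : View z2

  view : ∀ x → View x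
  view x with split N N x
  ... | inr j with split c 1 j
  ...   | inl h = v2 h
  ...   | inr zero = w2
  view x | inl i with split c 1 i
  ...   | inl h = v1 h
  ...   | inr zero = w1

  a11 : ∀ h h' → adj G2 (q1 h) (q1 h') ≡ adj (K c) h h'
  a11 h h' = trans (adj-ll false FK FK (h ↑ˡ 1) (h' ↑ˡ 1)) (adj-ll false (K c) (K 1) h h')
  a22 : ∀ h h' → adj G2 (q2 h) (q2 h') ≡ adj (K c) h h'
  a22 h h' = trans (adj-rr false FK FK (h ↑ˡ 1) (h' ↑ˡ 1)) (adj-ll false (K c) (K 1) h h')
  a12 : ∀ (x y : Fin N) → adj G2 (x ↑ˡ N) (N ↑ʳ y) ≡ false
  a12 x y = adj-lr false FK FK x y
  a21 : ∀ (x y : Fin N) → adj G2 (N ↑ʳ y) (x ↑ˡ N) ≡ false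
  a21 x y = adj-rl false FK FK x y
  aq1z1 : ∀ h → adj G2 (q1 h) z1 ≡ false
  aq1z1 h = trans (adj-ll false FK FK (h ↑ˡ 1) (c ↑ʳ zero)) (adj-lr false (K c) (K 1) h zero)
  az1q1 : ∀ h → adj G2 z1 (q1 h) ≡ false
  az1q1 h = trans (adj-ll false FK FK (c ↑ʳ zero) (h ↑ˡ 1)) (adj-rl false (K c) (K 1) h zero)
  aq2z2 : ∀ h → adj G2 (q2 h) z2 ≡ false
  aq2z2 h = trans (adj-rr false FK FK (h ↑ˡ 1) (c ↑ʳ zero)) (adj-lr false (K c) (K 1) h zero)
  az2q2 : ∀ h → adj G2 z2 (q2 h) ≡ false
  az2q2 h = trans (adj-rr false FK FK (c ↑ʳ zero) (h ↑ˡ 1)) (adj-rl false (K c) (K 1) h zero)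

  -- A proper c-colouring of K_c is a bijection onto the colours, so matching colours exchanges
  -- the two copies of K_c and fixes both isolated vertices.
  module Exchange (D : DistColoring G2 c) where
    open DistColoring D
    g1 g2 : Fin c → Fin c
    g1 h = col (q1 h)
    g2 h = col (q2 h)
    g1inj : ∀ {h h'} → g1 h ≡ g1 h' → h ≡ h'
    g1inj {h} {h'} e with h ≟ h'
    ... | yes p = p
    ... | no ne = ⊥-elim (proper _ _ (trans (a11 h h') (K-adj _ _ ne)) e)
    g2inj : ∀ {h h'} → g2 h ≡ g2 h' → h ≡ h'
    g2inj {h} {h'} e with h ≟ h'
    ... | yes p = p
    ... | no ne = ⊥-elim (proper _ _ (trans (a22 h h') (K-adj _ _ ne)) e)
    inv : (g : Fin c → Fin c) → (∀ {x y} → g x ≡ g y → x ≡ y) → Fin c → Fin c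
    inv g gi α = proj₁ (injective⇒surjective g (λ {x} {y} → gi {x} {y}) α)
    invR : ∀ g (gi : ∀ {x y} → g x ≡ g y → x ≡ y) α → g (inv g gi α) ≡ α
    invR g gi α = proj₂ (injective⇒surjective g (λ {x} {y} → gi {x} {y}) α)
    invL : ∀ g (gi : ∀ {x y} → g x ≡ g y → x ≡ y) h → inv g gi (g h) ≡ h
    invL g gi h = gi (invR g gi (g h))
    ψ ψ' : Fin c → Fin c
    ψ h = inv g2 g2inj (g1 h)
    ψ' h = inv g1 g1inj (g2 h)
    ψψ' : ∀ h → ψ (ψ' h) ≡ h
    ψψ' h = trans (cong (inv g2 g2inj) (invR g1 g1inj (g2 h))) (invL g2 g2inj h)
    ψ'ψ : ∀ h → ψ' (ψ h) ≡ h
    ψ'ψ h = trans (cong (inv g1 g1inj) (invR g2 g2inj (g1 h))) (invL g1 g1inj h)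
    ψinj : ∀ {x y} → ψ x ≡ ψ y → x ≡ y
    ψinj {x} {y} e = trans (sym (ψ'ψ x)) (trans (cong ψ' e) (ψ'ψ y))
    ψ'inj : ∀ {x y} → ψ' x ≡ ψ' y → x ≡ y
    ψ'inj {x} {y} e = trans (sym (ψψ' x)) (trans (cong ψ e) (ψψ' y))
    s : Fin (N + N) → Fin (N + N)
    sA sB : Fin N → Fin (N + N)
    sA = cases (λ h → q2 (ψ h)) (λ _ → z1)
    sB = cases (λ h → q1 (ψ' h)) (λ _ → z2)
    s = cases sA sB
    s1 : ∀ h → s (q1 h) ≡ q2 (ψ h)
    s1 h = trans (casesL sA sB (h ↑ˡ 1)) (casesL (λ h → q2 (ψ h)) (λ _ → z1) h)
    s2 : ∀ h → s (q2 h) ≡ q1 (ψ' h)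
    s2 h = trans (casesR {N} sA sB (h ↑ˡ 1)) (casesL (λ h → q1 (ψ' h)) (λ _ → z2) h)
    sz1 : s z1 ≡ z1
    sz1 = trans (casesL sA sB (c ↑ʳ zero)) (casesR {c} (λ h → q2 (ψ h)) (λ _ → z1) zero)
    sz2 : s z2 ≡ z2
    sz2 = trans (casesR {N} sA sB (c ↑ʳ zero)) (casesR {c} (λ h → q1 (ψ' h)) (λ _ → z2) zero)
    inv2 : ∀ x → s (s x) ≡ x
    inv2 x with view x
    ... | v1 h = trans (cong s (s1 h)) (trans (s2 (ψ h)) (cong q1 (ψ'ψ h)))
    ... | v2 h = trans (cong s (s2 h)) (trans (s1 (ψ' h)) (cong q2 (ψψ' h)))
    ... | w1 = trans (cong s sz1) sz1
    ... | w2 = trans (cong s sz2) sz2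
    pres : ∀ x y → adj G2 (s x) (s y) ≡ adj G2 x y
    pres x y with view x | view y
    ... | v1 h | v1 h' rewrite s1 h | s1 h' = trans (a22 (ψ h) (ψ h')) (trans (K-preserves ψ (λ {x} {y} → ψinj {x} {y}) h h') (sym (a11 h h')))
    ... | v1 h | v2 h' rewrite s1 h | s2 h' = trans (a21 (ψ' h' ↑ˡ 1) (ψ h ↑ˡ 1)) (sym (a12 (h ↑ˡ 1) (h' ↑ˡ 1)))
    ... | v1 h | w1 rewrite s1 h | sz1 = trans (a21 (c ↑ʳ zero) (ψ h ↑ˡ 1)) (sym (aq1z1 h))
    ... | v1 h | w2 rewrite s1 h | sz2 = trans (aq2z2 (ψ h)) (sym (a12 (h ↑ˡ 1) (c ↑ʳ zero)))
    ... | v2 h | v1 h' rewrite s2 h | s1 h' = trans (a12 (ψ' h ↑ˡ 1) (ψ h' ↑ˡ 1)) (sym (a21 (h' ↑ˡ 1) (h ↑ˡ 1)))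
    ... | v2 h | v2 h' rewrite s2 h | s2 h' = trans (a11 (ψ' h) (ψ' h')) (trans (K-preserves ψ' (λ {x} {y} → ψ'inj {x} {y}) h h') (sym (a22 h h')))
    ... | v2 h | w1 rewrite s2 h | sz1 = trans (aq1z1 (ψ' h)) (sym (a21 (c ↑ʳ zero) (h ↑ˡ 1)))
    ... | v2 h | w2 rewrite s2 h | sz2 = trans (a12 (ψ' h ↑ˡ 1) (c ↑ʳ zero)) (sym (aq2z2 h))
    ... | w1 | v1 h rewrite sz1 | s1 h = trans (a12 (c ↑ʳ zero) (ψ h ↑ˡ 1)) (sym (az1q1 h))
    ... | w1 | v2 h rewrite sz1 | s2 h = trans (az1q1 (ψ' h)) (sym (a12 (c ↑ʳ zero) (h ↑ˡ 1)))
    ... | w1 | w1 rewrite sz1 = refl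
    ... | w1 | w2 rewrite sz1 | sz2 = refl
    ... | w2 | v1 h rewrite sz2 | s1 h = trans (az2q2 (ψ h)) (sym (a21 (h ↑ˡ 1) (c ↑ʳ zero)))
    ... | w2 | v2 h rewrite sz2 | s2 h = trans (a21 (ψ' h ↑ˡ 1) (c ↑ʳ zero)) (sym (az2q2 h))
    ... | w2 | w1 rewrite sz2 | sz1 = refl
    ... | w2 | w2 rewrite sz2 = refl
    σ : Aut G2
    σ = involution⇒Aut G2 s inv2 pres
    cp : ∀ x → col (s x) ≡ col x
    cp x with view x
    ... | v1 h = trans (cong col (s1 h)) (invR g2 g2inj (g1 h))
    ... | v2 h = trans (cong col (s2 h)) (invR g1 g1inj (g2 h))
    ... | w1 = cong col sz1
    ... | w2 = cong col sz2
    q1≢q2 : s (q1 zero) ≢ q1 zero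
    q1≢q2 e = ↑ˡ≢↑ʳ {N} {N} (zero ↑ˡ 1) (ψ zero ↑ˡ 1) (sym (trans (sym (s1 zero)) e))

  no-dist : DistColoring G2 c → ⊥
  no-dist D = q1≢q2 (distinguishing σ cp (q1 zero))
    where
    open DistColoring D
    open Exchange D

another-part : ∀ {k} → 2 ≤ k → (β : Fin k) → Σ (Fin k) λ γ → γ ≢ β
another-part {suc (suc k)} _ zero = suc zero , λ ()
another-part {suc (suc k)} _ (suc β) = zero , λ ()
another-part {suc zero} (s≤s ()) zero

some-part : ∀ {k} → 2 ≤ k → Fin k
some-part {suc (suc k)} _ = zero
some-part {suc zero} (s≤s ())

module Multipartite {c : ℕ} (H : Graph c) (cm : CompleteMultipartite≥2 H) where
  private
    two = proj₁ (proj₂ cm)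
    p = proj₁ (proj₂ (proj₂ cm))
    surjp = proj₁ (proj₂ (proj₂ (proj₂ cm)))
    rel = proj₂ (proj₂ (proj₂ (proj₂ cm)))

  part : Fin c → Fin (proj₁ cm)
  part = p

  adj-parts : ∀ i j → p i ≢ p j → adj H i j ≡ true
  adj-parts i j = proj₂ (rel i j)

  nonadj-part : ∀ i j → adj H i j ≡ false → p i ≡ p j
  nonadj-part i j na with p i F.≟ p j
  ... | yes e = e
  ... | no ne = ⊥-elim (true≢false (trans (sym (adj-parts i j ne)) na))

  other : ∀ h → Σ (Fin c) λ g → p g ≢ p h
  other h with another-part two (p h)
  ... | γ , ne with surjp γ
  ... | g , e = g , λ e' → ne (trans (sym e) e')

  neighbour : ∀ h → ∃ λ g → adj H h g ≡ true
  neighbour h with other h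
  ... | g , ne = g , adj-parts h g (λ e → ne (sym e))

  edge : Σ (Fin c) λ h0 → Σ (Fin c) λ h1 → adj H h0 h1 ≡ true
  edge with surjp (some-part two)
  ... | h0 , _ = h0 , neighbour h0

  within-two-steps : ∀ x h → h ≡ x ⊎ adj H x h ≡ true ⊎ ∃ λ s → adj H x s ≡ true × adj H s h ≡ true
  within-two-steps x h with h ≟ x
  ... | yes e = inj₁ e
  ... | no _ with p h F.≟ p x
  ...   | no ne = inj₂ (inj₁ (adj-parts x h (λ e → ne (sym e))))
  ...   | yes e = inj₂ (inj₂ (proj₁ (other x) , adj-parts x _ (λ e' → proj₂ (other x) (sym e')) ,
                              adj-parts _ h (λ e' → proj₂ (other x) (trans e' e))))

JoinHK₁-dist : ∀ {a c} (M : Graph (suc a)) {H : Graph c} → CompleteMultipartite≥2 H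
  → DistColoring ((M ∨ (H ∪ K 1)) ∪ (M ∨ (H ∪ K 1))) (suc a + c)
JoinHK₁-dist M {H} cm with Multipartite.edge H cm
... | h0 , h1 , a01 = JoinHK₁.dist M H h0 h1 a01

HK₁-noncomplete-dist : ∀ {c} {H : Graph c} → CompleteMultipartite≥2 H → NonEdge H
  → DistColoring ((H ∪ K 1) ∪ (H ∪ K 1)) c
HK₁-noncomplete-dist {H = H} cm (x , x' , xx' , axx') =
  HK₁-noncomplete.dist H x x' y xx' axx' (adj-parts x y (≢-sym py)) (adj-parts x' y (λ e → py (sym (trans x~x' e))))
                       neighbour (within-two-steps x)
  where
  open Multipartite H cm
  y = proj₁ (other x)
  py = proj₂ (other x)
  x~x' : part x ≡ part x'
  x~x' = nonadj-part x x' axx'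

module Double (m : ℕ) (G : Graph (suc (suc (suc (suc m))))) (hχ : IsχD G (suc (suc (suc m)))) where
  private
    k : ℕ
    k = suc (suc m)

  double-≥ : ∀ j → DistColoring (G ∪ G) j → suc k ≤ j
  double-≥ j D = χD-≤ hχ (proj₁ (restrictLeft D)) (proj₂ (restrictLeft D))

  formA⇒dist : FormA1 G ⊎ FormA2 G → DistColoring (G ∪ G) (suc k)
  formA⇒dist (inj₁ (suc a , M , _ , _ , inj₁ φ)) =
    subst (DistColoring (G ∪ G)) (ℕ.suc-injective (trans (sym (ℕ.+-suc (suc a) 3)) (sym (≅-order φ))))
      (DistColoring-≅ (∪-self-cong φ) (Join2K₂.dist M))
  formA⇒dist (inj₁ (suc a , M , _ , _ , inj₂ (c , H , cm , φ))) =
    subst (DistColoring (G ∪ G)) (ℕ.suc-injective (trans (sym (ℕ.+-suc (suc a) c)) (trans (cong (suc a +_) (ℕ.+-comm 1 c)) (sym (≅-order φ)))))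
      (DistColoring-≅ (∪-self-cong φ) (JoinHK₁-dist M cm))
  formA⇒dist (inj₂ (c , H , cm , φ , nK)) =
    subst (DistColoring (G ∪ G)) (ℕ.suc-injective (trans (ℕ.+-comm 1 c) (sym (≅-order φ))))
      (DistColoring-≅ (∪-self-cong φ) (HK₁-noncomplete-dist cm (¬complete⇒nonEdge H nK)))

  formB⇒dist : FormB G → DistColoring (G ∪ G) (suc (suc k))
  formB⇒dist (inj₁ φ) = subst (DistColoring (G ∪ G)) (sym (≅-order φ)) (DistColoring-≅ (∪-self-cong φ) dist-4K₂)
  formB⇒dist (inj₂ φ) = DistColoring-≅ (∪-self-cong φ) (KK₁-upper.dist (suc m))

  formB⇒¬dist : FormB G → ¬ DistColoring (G ∪ G) (suc k)
  formB⇒¬dist (inj₁ φ) D = no-dist-4K₂-3 (subst (DistColoring 4K₂) (ℕ.suc-injective (≅-order φ)) (DistColoring-≅ (≅-sym (∪-self-cong φ)) D))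
  formB⇒¬dist (inj₂ φ) D = KK₁-lower.no-dist k (DistColoring-≅ (≅-sym (∪-self-cong φ)) D)

  χD-double≡χD⇔formA : IsχD (G ∪ G) (suc k) ⇔ (FormA1 G ⊎ FormA2 G)
  χD-double≡χD⇔formA = mk⇔ forward (λ h → formA⇒dist h , double-≥)
    where
    forward : IsχD (G ∪ G) (suc k) → FormA1 G ⊎ FormA2 G
    forward (D , _) = by-form (Decomposition.forms G hχ)
      where
      by-form : FormA1 G ⊎ FormA2 G ⊎ FormB G → FormA1 G ⊎ FormA2 G
      by-form (inj₁ a) = inj₁ a
      by-form (inj₂ (inj₁ a)) = inj₂ a
      by-form (inj₂ (inj₂ b)) = ⊥-elim (formB⇒¬dist b D)

  χD-double≡suc-χD⇔formB : IsχD (G ∪ G) (suc (suc k)) ⇔ FormB G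
  χD-double≡suc-χD⇔formB = mk⇔ forward
    (λ b → formB⇒dist b , λ j D → ℕ.≤∧≢⇒< (double-≥ j D) (λ e → formB⇒¬dist b (subst (DistColoring (G ∪ G)) (sym e) D)))
    where
    forward : IsχD (G ∪ G) (suc (suc k)) → FormB G
    forward (_ , min) = by-form (Decomposition.forms G hχ)
      where
      by-form : FormA1 G ⊎ FormA2 G ⊎ FormB G → FormB G
      by-form (inj₁ a) = ⊥-elim (ℕ.1+n≰n (min (suc k) (formA⇒dist (inj₁ a))))
      by-form (inj₂ (inj₁ a)) = ⊥-elim (ℕ.1+n≰n (min (suc k) (formA⇒dist (inj₂ a))))
      by-form (inj₂ (inj₂ b)) = b

theorem5p10 : (n : ℕ) → 3 < n → (G : Graph n) → IsχD G (n ∸ 1) →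
  (IsχD (G ∪ G) (n ∸ 1) ⇔
    ((Σ ℕ λ a → Σ (Graph a) λ M → 1 ≤ a × CompleteMultipartite M ×
        ((G ≅ (M ∨ 2K₂)) ⊎
         (Σ ℕ λ c → Σ (Graph c) λ H → CompleteMultipartite≥2 H × (G ≅ (M ∨ (H ∪ K 1))))))
     ⊎
     (Σ ℕ λ c → Σ (Graph c) λ H → CompleteMultipartite≥2 H × (G ≅ (H ∪ K 1)) × ¬ (H ≅ K c))))
  ×
  (IsχD (G ∪ G) (suc (n ∸ 1)) ⇔ ((G ≅ 2K₂) ⊎ (G ≅ (K (n ∸ 1) ∪ K 1))))
theorem5p10 _ (s≤s (s≤s (s≤s (s≤s (z≤n {m}))))) G hχ =
  Double.χD-double≡χD⇔formA m G hχ , Double.χD-double≡suc-χD⇔formB m G hχ
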